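{- Let $f=\sum_{n\ge0}|\operatorname{Av}_n(231)^{+1}|x^n$ and $c=\frac{1-\sqrt{1-4x}}{2x}=\sum_{n\ge0}C_nx^n$ be the generating function of the Catalan numbers. The generating function (by length) of the permutations in $\operatorname{Av}(231)^{+1}\setminus\operatorname{Av}(231)$ in which the greatest entry is not involved in any occurrence of $231$ is $2(f-c)xc$.
   Context: A permutation $\pi$ contains $\sigma$ if $\pi$ has a subsequence order isomorphic to $\sigma$ (an occurrence of $\sigma$); otherwise $\pi$ avoids $\sigma$. $\operatorname{Av}(231)$ is the class of $231$-avoiding permutations (counted by the Catalan numbers), and $\operatorname{Av}(231)^{+1}$ is the set of permutations from which one can remove at most one entry to obtain a $231$-avoiding permutation; $\operatorname{Av}_n(231)^{+1}$ denotes its elements of length $n$. The generating function of a set of permutations is $\sum_n a_n x^n$ where $a_n$ is the number of its elements of length $n$. -}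

module Defs where

open import Data.Nat using (ℕ; zero; suc; _<_; _≤_; _∸_; _/_; _*_; _<ᵇ_)
open import Data.Nat.Combinatorics using (_C_)
open import Data.Bool using (if_then_else_)
open import Data.Fin using (Fin)
import Data.Fin as F
open import Data.Vec using (Vec; lookup; removeAt; map)
open import Data.List using (List; length)
open import Data.List.Membership.Propositional using (_∈_)
open import Data.List.Relation.Unary.Unique.Propositional using (Unique)
open import Data.Product using (_×_; ∃; ∃-syntax)
open import Data.Sum using (_⊎_)
open import Function.Bundles using (_⇔_)
open import Relation.Binary.PropositionalEquality using (_≡_; _≢_)
open import Relation.Nullary using (¬_)
open import Data.Integer as ℤ using (ℤ; +_)

IsPerm : {n : ℕ} → Vec ℕ n → Set
IsPerm {n} π = ((i : Fin n) → lookup π i < n)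
             × ((i j : Fin n) → lookup π i ≡ lookup π j → i ≡ j)

Occ231 : {n : ℕ} → Vec ℕ n → Fin n → Fin n → Fin n → Set
Occ231 π i j k = (i F.< j) × (j F.< k) × (lookup π k < lookup π i) × (lookup π i < lookup π j)

Contains231 : {n : ℕ} → Vec ℕ n → Set
Contains231 {n} π = ∃[ i ] ∃[ j ] ∃[ k ] Occ231 π i j k

Avoids231 : {n : ℕ} → Vec ℕ n → Set
Avoids231 π = ¬ Contains231 π

-- Standardisation after deleting the value v: entries above v drop by one.
shiftDown : ℕ → ℕ → ℕ
shiftDown v w = if w <ᵇ v then w else w ∸ 1

deleteEntry : {n : ℕ} → Vec ℕ (suc n) → Fin (suc n) → Vec ℕ n
deleteEntry π i = map (shiftDown (lookup π i)) (removeAt π i)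

InAv231+1 : {n : ℕ} → Vec ℕ n → Set
InAv231+1 {zero}  π = Avoids231 π
InAv231+1 {suc n} π = Avoids231 π ⊎ (∃[ i ] Avoids231 (deleteEntry π i))

IsGreatestPos : {n : ℕ} → Vec ℕ n → Fin n → Set
IsGreatestPos π p = ∀ q → lookup π q ≤ lookup π p

MaxNotIn231 : {n : ℕ} → Vec ℕ n → Set
MaxNotIn231 π = ∀ i j k → Occ231 π i j k → ∀ p → IsGreatestPos π p →
                (p ≢ i) × (p ≢ j) × (p ≢ k)

Av231+1 : (n : ℕ) → Vec ℕ n → Set
Av231+1 n π = IsPerm π × InAv231+1 π

Target : (n : ℕ) → Vec ℕ n → Set
Target n π = IsPerm π × InAv231+1 π × Contains231 π × MaxNotIn231 π

HasCard : {n : ℕ} → (Vec ℕ n → Set) → ℕ → Set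
HasCard {n} P a = ∃[ L ] (Unique L × ((π : Vec ℕ n) → (π ∈ L) ⇔ P π) × (length L ≡ a))

catalan : ℕ → ℕ
catalan n = ((2 * n) C n) / suc n

sumZ : (ℕ → ℤ) → ℕ → ℤ
sumZ g zero    = g zero
sumZ g (suc n) = sumZ g n ℤ.+ g (suc n)

-- Coefficient of x^n in 2 (f - c) x c, where f has coefficients fc and c = Σ C_n x^n.
targetCoeff : (ℕ → ℕ) → ℕ → ℤ
targetCoeff fc zero    = + 0
targetCoeff fc (suc n) =
  + 2 ℤ.* sumZ (λ i → ((+ fc i) ℤ.- (+ catalan i)) ℤ.* (+ catalan (n ∸ i))) n

-- Write a permutation of length n + 1 as α n γ around its maximum n. The maximum lies in no
-- occurrence of 231 exactly when every entry of α is smaller than every entry of γ, and then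
-- the permutation is α ⊕ (1 ⊖ β) for the permutation β order-isomorphic to γ. Such a sum
-- contains 231 iff α or β does, and it lies in Av(231)^{+1} \ Av(231) iff one of α, β does and
-- the other avoids 231. Hence the permutations counted number
-- Σ_{i ≤ n} (d_i C_{n-i} + C_i d_{n-i}) = 2 Σ_{i ≤ n} d_i C_{n-i}, where C_i = |Av_i(231)| and
-- d_i = f_i - C_i counts Av_i(231)^{+1} \ Av_i(231).
--
-- The same decomposition gives Segner's recurrence C_{n+1} = Σ_{i ≤ n} C_i C_{n-i}. For the
-- closed form, c = Σ C_n x^n satisfies c = 1 + x c², so s = 1 - 2 x c has s² = 1 - 4 x and
-- x c′ s = c - 1. Comparing coefficients in (1 - 4 x) x c′ = (c - 1) s yields
-- (n + 2) C_{n+1} = (4 n + 2) C_n, that is (n + 1) C_n = binom(2n, n).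

module Submission where

open import Data.Nat using (ℕ; zero; suc)

module PowerSeries where
  open import Data.Integer using (ℤ; +_; 0ℤ; 1ℤ; _+_; _-_; _*_)
  open import Data.Integer.Properties
    using (+-identityˡ; +-identityʳ; *-identityˡ; *-identityʳ; *-zeroʳ; *-comm;
           *-distribʳ-+)
  open import Data.Integer.Tactic.RingSolver using (solve-∀)
  open import Function using (_∘_)
  open import Relation.Binary.PropositionalEquality
    using (_≡_; refl; sym; trans; cong; cong₂; _≗_; module ≡-Reasoning)
  open ≡-Reasoning

  Series : Set
  Series = ℕ → ℤ

  tail : Series → Series
  tail f n = f (suc n)

  infixl 7 _⋆_ _·_
  infixl 6 _⊕_ _⊖_

  _⋆_ : Series → Series → Series
  (f ⋆ g) zero    = f 0 * g 0
  (f ⋆ g) (suc n) = f 0 * g (suc n) + (tail f ⋆ g) n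

  _⊕_ _⊖_ : Series → Series → Series
  (f ⊕ g) n = f n + g n
  (f ⊖ g) n = f n - g n

  _·_ : ℤ → Series → Series
  (a · f) n = a * f n

  x·_ : Series → Series
  (x· f) zero    = 0ℤ
  (x· f) (suc n) = f n

  𝟙 : Series
  𝟙 zero    = 1ℤ
  𝟙 (suc n) = 0ℤ

  -- The Euler operator x d/dx.
  θ : Series → Series
  θ f n = + n * f n

  ⋆-congˡ : ∀ {f f′} g → f ≗ f′ → f ⋆ g ≗ f′ ⋆ g
  ⋆-congˡ g f≗f′ zero    = cong (_* g 0) (f≗f′ 0)
  ⋆-congˡ g f≗f′ (suc n) =
    cong₂ _+_ (cong (_* g (suc n)) (f≗f′ 0)) (⋆-congˡ g (f≗f′ ∘ suc) n)

  ⋆-congʳ : ∀ f {g g′} → g ≗ g′ → f ⋆ g ≗ f ⋆ g′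
  ⋆-congʳ f g≗g′ zero    = cong (f 0 *_) (g≗g′ 0)
  ⋆-congʳ f g≗g′ (suc n) =
    cong₂ _+_ (cong (f 0 *_) (g≗g′ (suc n))) (⋆-congʳ (tail f) g≗g′ n)

  ⋆-distribʳ-⊕ : ∀ f h g → (f ⊕ h) ⋆ g ≗ f ⋆ g ⊕ h ⋆ g
  ⋆-distribʳ-⊕ f h g zero    = *-distribʳ-+ (g 0) (f 0) (h 0)
  ⋆-distribʳ-⊕ f h g (suc n) =
    trans (cong (_+_ ((f 0 + h 0) * g (suc n))) (⋆-distribʳ-⊕ (tail f) (tail h) g n))
          (ring (f 0) (h 0) (g (suc n)) ((tail f ⋆ g) n) ((tail h ⋆ g) n))
    where
    ring : ∀ a b c x y → (a + b) * c + (x + y) ≡ (a * c + x) + (b * c + y)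
    ring = solve-∀

  ⋆-distribʳ-⊖ : ∀ f h g → (f ⊖ h) ⋆ g ≗ f ⋆ g ⊖ h ⋆ g
  ⋆-distribʳ-⊖ f h g zero    = ring (f 0) (h 0) (g 0)
    where
    ring : ∀ a b c → (a - b) * c ≡ a * c - b * c
    ring = solve-∀
  ⋆-distribʳ-⊖ f h g (suc n) =
    trans (cong (_+_ ((f 0 - h 0) * g (suc n))) (⋆-distribʳ-⊖ (tail f) (tail h) g n))
          (ring (f 0) (h 0) (g (suc n)) ((tail f ⋆ g) n) ((tail h ⋆ g) n))
    where
    ring : ∀ a b c x y → (a - b) * c + (x - y) ≡ (a * c + x) - (b * c + y)
    ring = solve-∀

  ⋆-distribˡ-⊖ : ∀ f g h → f ⋆ (g ⊖ h) ≗ f ⋆ g ⊖ f ⋆ h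
  ⋆-distribˡ-⊖ f g h zero    = ring (f 0) (g 0) (h 0)
    where
    ring : ∀ a b c → a * (b - c) ≡ a * b - a * c
    ring = solve-∀
  ⋆-distribˡ-⊖ f g h (suc n) =
    trans (cong (_+_ (f 0 * (g (suc n) - h (suc n)))) (⋆-distribˡ-⊖ (tail f) g h n))
          (ring (f 0) (g (suc n)) (h (suc n)) ((tail f ⋆ g) n) ((tail f ⋆ h) n))
    where
    ring : ∀ a b c x y → a * (b - c) + (x - y) ≡ (a * b + x) - (a * c + y)
    ring = solve-∀

  ⋆-assocˡ-· : ∀ a f g → (a · f) ⋆ g ≗ a · (f ⋆ g)
  ⋆-assocˡ-· a f g zero    = ring a (f 0) (g 0)
    where
    ring : ∀ a b c → (a * b) * c ≡ a * (b * c)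
    ring = solve-∀
  ⋆-assocˡ-· a f g (suc n) =
    trans (cong (_+_ ((a * f 0) * g (suc n))) (⋆-assocˡ-· a (tail f) g n))
          (ring a (f 0) (g (suc n)) ((tail f ⋆ g) n))
    where
    ring : ∀ a b c x → (a * b) * c + a * x ≡ a * (b * c + x)
    ring = solve-∀

  ⋆-assocʳ-· : ∀ a f g → f ⋆ (a · g) ≗ a · (f ⋆ g)
  ⋆-assocʳ-· a f g zero    = ring a (f 0) (g 0)
    where
    ring : ∀ a b c → b * (a * c) ≡ a * (b * c)
    ring = solve-∀
  ⋆-assocʳ-· a f g (suc n) =
    trans (cong (_+_ (f 0 * (a * g (suc n)))) (⋆-assocʳ-· a (tail f) g n))
          (ring a (f 0) (g (suc n)) ((tail f ⋆ g) n))
    where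
    ring : ∀ a b c x → b * (a * c) + a * x ≡ a * (b * c + x)
    ring = solve-∀

  ⋆-x·ˡ : ∀ f g → x· f ⋆ g ≗ x· (f ⋆ g)
  ⋆-x·ˡ f g zero    = refl
  ⋆-x·ˡ f g (suc n) = +-identityˡ _

  ⋆-x·ʳ : ∀ f g → f ⋆ x· g ≗ x· (f ⋆ g)
  ⋆-x·ʳ f g zero          = *-zeroʳ (f 0)
  ⋆-x·ʳ f g (suc zero)    = trans (cong (_+_ (f 0 * g 0)) (*-zeroʳ (f 1))) (+-identityʳ _)
  ⋆-x·ʳ f g (suc (suc n)) = cong (_+_ (f 0 * g (suc n))) (⋆-x·ʳ (tail f) g (suc n))

  ⋆-identityʳ : ∀ f → f ⋆ 𝟙 ≗ f
  ⋆-identityʳ f zero    = *-identityʳ (f 0)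
  ⋆-identityʳ f (suc n) =
    trans (cong₂ _+_ (*-zeroʳ (f 0)) (⋆-identityʳ (tail f) n)) (+-identityˡ _)

  ⋆-zeroˡ : ∀ g → (λ _ → 0ℤ) ⋆ g ≗ (λ _ → 0ℤ)
  ⋆-zeroˡ g zero    = refl
  ⋆-zeroˡ g (suc n) = trans (+-identityˡ _) (⋆-zeroˡ g n)

  ⋆-identityˡ : ∀ g → 𝟙 ⋆ g ≗ g
  ⋆-identityˡ g zero    = *-identityˡ (g 0)
  ⋆-identityˡ g (suc n) =
    trans (cong₂ _+_ (*-identityˡ (g (suc n))) (⋆-zeroˡ g n)) (+-identityʳ _)

  ⋆-suc-swap : ∀ f g n → (f ⋆ g) (suc n) ≡ g 0 * f (suc n) + (f ⋆ tail g) n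
  ⋆-suc-swap f g zero    = ring (f 0) (g 1) (f 1) (g 0)
    where
    ring : ∀ a b c d → a * b + c * d ≡ d * c + a * b
    ring = solve-∀
  ⋆-suc-swap f g (suc n) =
    trans (cong (_+_ (f 0 * g (suc (suc n)))) (⋆-suc-swap (tail f) g n))
          (ring (f 0) (g (suc (suc n))) (g 0) (f (suc (suc n))) ((tail f ⋆ tail g) n))
    where
    ring : ∀ a b c d x → a * b + (c * d + x) ≡ c * d + (a * b + x)
    ring = solve-∀

  ⋆-comm : ∀ f g → f ⋆ g ≗ g ⋆ f
  ⋆-comm f g zero    = *-comm (f 0) (g 0)
  ⋆-comm f g (suc n) =
    sym (trans (⋆-suc-swap g f n) (cong (_+_ (f 0 * g (suc n))) (sym (⋆-comm (tail f) g n))))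

  ⋆-unfoldˡ : ∀ f g → f ⋆ g ≗ f 0 · g ⊕ x· (tail f ⋆ g)
  ⋆-unfoldˡ f g zero    = sym (+-identityʳ _)
  ⋆-unfoldˡ f g (suc n) = refl

  ⋆-assoc : ∀ f g h → (f ⋆ g) ⋆ h ≗ f ⋆ (g ⋆ h)
  ⋆-assoc f g h n = begin
    ((f ⋆ g) ⋆ h) n                                 ≡⟨ ⋆-congˡ h (⋆-unfoldˡ f g) n ⟩
    ((f 0 · g ⊕ x· (tail f ⋆ g)) ⋆ h) n             ≡⟨ ⋆-distribʳ-⊕ _ _ h n ⟩
    ((f 0 · g) ⋆ h) n + (x· (tail f ⋆ g) ⋆ h) n     ≡⟨ cong₂ _+_ (⋆-assocˡ-· (f 0) g h n)
                                                                 (⋆-x·ˡ (tail f ⋆ g) h n) ⟩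
    f 0 * (g ⋆ h) n + (x· ((tail f ⋆ g) ⋆ h)) n     ≡⟨ cong (_+_ (f 0 * (g ⋆ h) n)) (shifted n) ⟩
    f 0 * (g ⋆ h) n + (x· (tail f ⋆ (g ⋆ h))) n     ≡⟨ ⋆-unfoldˡ f (g ⋆ h) n ⟨
    (f ⋆ (g ⋆ h)) n                                 ∎
    where
    shifted : ∀ n → (x· ((tail f ⋆ g) ⋆ h)) n ≡ (x· (tail f ⋆ (g ⋆ h))) n
    shifted zero    = refl
    shifted (suc m) = ⋆-assoc (tail f) g h m

  θ-tail : ∀ f → tail f ⊕ θ (tail f) ≗ tail (θ f)
  θ-tail f n = ring (+ n) (f (suc n))
    where
    ring : ∀ P x → x + P * x ≡ (1ℤ + P) * x
    ring = solve-∀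

  θ-leibniz : ∀ f g → θ (f ⋆ g) ≗ θ f ⋆ g ⊕ f ⋆ θ g
  θ-leibniz f g zero    = ring (f 0) (g 0)
    where
    ring : ∀ a b → + 0 * (a * b) ≡ (+ 0 * a) * b + a * (+ 0 * b)
    ring = solve-∀
  θ-leibniz f g (suc n) = begin
    (1ℤ + + n) * (f 0 * g (suc n) + (tail f ⋆ g) n)
      ≡⟨ ring (+ n) (f 0) (g (suc n)) ((tail f ⋆ g) n) ⟩
    θ f 0 * g (suc n) + ((tail f ⋆ g) n + θ (tail f ⋆ g) n) + f 0 * θ g (suc n)
      ≡⟨ cong (λ z → θ f 0 * g (suc n) + ((tail f ⋆ g) n + z) + f 0 * θ g (suc n))
              (θ-leibniz (tail f) g n) ⟩
    θ f 0 * g (suc n) + ((tail f ⋆ g) n + ((θ (tail f) ⋆ g) n + (tail f ⋆ θ g) n))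
      + f 0 * θ g (suc n)
      ≡⟨ ring′ (θ f 0 * g (suc n)) (f 0 * θ g (suc n))
              ((tail f ⋆ g) n) ((θ (tail f) ⋆ g) n) ((tail f ⋆ θ g) n) ⟩
    θ f 0 * g (suc n) + ((tail f ⋆ g) n + (θ (tail f) ⋆ g) n)
      + (f 0 * θ g (suc n) + (tail f ⋆ θ g) n)
      ≡⟨ cong (λ z → θ f 0 * g (suc n) + z + (f 0 * θ g (suc n) + (tail f ⋆ θ g) n))
              (trans (sym (⋆-distribʳ-⊕ (tail f) (θ (tail f)) g n)) (⋆-congˡ g (θ-tail f) n)) ⟩
    (θ f ⋆ g ⊕ f ⋆ θ g) (suc n)
      ∎
    where
    ring : ∀ P A B C → (1ℤ + P) * (A * B + C)
                       ≡ (+ 0 * A) * B + (C + P * C) + A * ((1ℤ + P) * B)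
    ring = solve-∀
    ring′ : ∀ X Y C D E → X + (C + (D + E)) + Y ≡ X + (C + D) + (Y + E)
    ring′ = solve-∀


  module Segner (a : Series) (a-zero : a 0 ≡ 1ℤ) (a-suc : ∀ n → a (suc n) ≡ (a ⋆ a) n) where

    s : Series
    s = 𝟙 ⊖ + 2 · x· a

    θa-suc : ∀ n → θ a (suc n) ≡ (a ⋆ a) n + + 2 * (a ⋆ θ a) n
    θa-suc n = begin
      (1ℤ + + n) * a (suc n)                       ≡⟨ cong (_*_ (1ℤ + + n)) (a-suc n) ⟩
      (1ℤ + + n) * (a ⋆ a) n                       ≡⟨ ring₁ (+ n) ((a ⋆ a) n) ⟩
      (a ⋆ a) n + θ (a ⋆ a) n                      ≡⟨ cong (_+_ ((a ⋆ a) n)) (θ-leibniz a a n) ⟩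
      (a ⋆ a) n + ((θ a ⋆ a) n + (a ⋆ θ a) n)      ≡⟨ cong (λ z → (a ⋆ a) n + (z + (a ⋆ θ a) n))
                                                           (⋆-comm (θ a) a n) ⟩
      (a ⋆ a) n + ((a ⋆ θ a) n + (a ⋆ θ a) n)      ≡⟨ ring₂ ((a ⋆ a) n) ((a ⋆ θ a) n) ⟩
      (a ⋆ a) n + + 2 * (a ⋆ θ a) n                ∎
      where
      ring₁ : ∀ P X → (1ℤ + P) * X ≡ X + P * X
      ring₁ = solve-∀
      ring₂ : ∀ X Y → X + (Y + Y) ≡ X + + 2 * Y
      ring₂ = solve-∀

    ⋆-s : ∀ f → f ⋆ s ≗ f ⊖ + 2 · x· (f ⋆ a)
    ⋆-s f n = trans (⋆-distribˡ-⊖ f 𝟙 (+ 2 · x· a) n)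
                    (cong₂ _-_ (⋆-identityʳ f n)
                               (trans (⋆-assocʳ-· (+ 2) f (x· a) n)
                                      (cong (_*_ (+ 2)) (⋆-x·ʳ f a n))))

    θa⋆s : θ a ⋆ s ≗ a ⊖ 𝟙
    θa⋆s n = trans (⋆-s (θ a) n) (coefficient n)
      where
      coefficient : ∀ n → θ a n - + 2 * (x· (θ a ⋆ a)) n ≡ a n - 𝟙 n
      coefficient zero    rewrite a-zero = refl
      coefficient (suc n) = begin
        θ a (suc n) - + 2 * (θ a ⋆ a) n
          ≡⟨ cong₂ (λ x y → x - + 2 * y) (θa-suc n) (⋆-comm (θ a) a n) ⟩
        ((a ⋆ a) n + + 2 * (a ⋆ θ a) n) - + 2 * (a ⋆ θ a) n
          ≡⟨ ring ((a ⋆ a) n) ((a ⋆ θ a) n) ⟩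
        (a ⋆ a) n - 0ℤ
          ≡⟨ cong (_- 0ℤ) (a-suc n) ⟨
        a (suc n) - 0ℤ
          ∎
        where
        ring : ∀ X Y → (X + + 2 * Y) - + 2 * Y ≡ X - 0ℤ
        ring = solve-∀

    a⋆s : a ⋆ s ≗ + 2 · 𝟙 ⊖ a
    a⋆s n = trans (⋆-s a n) (coefficient n)
      where
      coefficient : ∀ n → a n - + 2 * (x· (a ⋆ a)) n ≡ + 2 * 𝟙 n - a n
      coefficient zero    rewrite a-zero = refl
      coefficient (suc n) rewrite a-suc n = ring ((a ⋆ a) n)
        where
        ring : ∀ X → X - + 2 * X ≡ + 2 * 0ℤ - X
        ring = solve-∀

    s⋆s : s ⋆ s ≗ 𝟙 ⊖ + 4 · x· 𝟙
    s⋆s n = trans (⋆-s s n) (coefficient n)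
      where
      coefficient : ∀ n → s n - + 2 * (x· (s ⋆ a)) n ≡ 𝟙 n - + 4 * (x· 𝟙) n
      coefficient zero    = refl
      coefficient (suc n) = begin
        s (suc n) - + 2 * (s ⋆ a) n       ≡⟨ cong (λ z → s (suc n) - + 2 * z)
                                                   (trans (⋆-comm s a n) (a⋆s n)) ⟩
        s (suc n) - + 2 * (+ 2 * 𝟙 n - a n) ≡⟨ ring (a n) (𝟙 n) ⟩
        0ℤ - + 4 * 𝟙 n                    ∎
        where
        ring : ∀ A E → (0ℤ - + 2 * A) - + 2 * (+ 2 * E - A) ≡ 0ℤ - + 4 * E
        ring = solve-∀

    θa-recurrence : ∀ n → θ a (suc n) - + 4 * θ a n ≡ + 2 * a n - a (suc n)
    θa-recurrence n = trans (sym via-s²) via-assoc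
      where
      via-s² : (θ a ⋆ (s ⋆ s)) (suc n) ≡ θ a (suc n) - + 4 * θ a n
      via-s² = begin
        (θ a ⋆ (s ⋆ s)) (suc n)
          ≡⟨ ⋆-congʳ (θ a) s⋆s (suc n) ⟩
        (θ a ⋆ (𝟙 ⊖ + 4 · x· 𝟙)) (suc n)
          ≡⟨ ⋆-distribˡ-⊖ (θ a) 𝟙 (+ 4 · x· 𝟙) (suc n) ⟩
        (θ a ⋆ 𝟙) (suc n) - (θ a ⋆ (+ 4 · x· 𝟙)) (suc n)
          ≡⟨ cong₂ _-_ (⋆-identityʳ (θ a) (suc n))
                       (trans (⋆-assocʳ-· (+ 4) (θ a) (x· 𝟙) (suc n))
                              (cong (_*_ (+ 4)) (trans (⋆-x·ʳ (θ a) 𝟙 (suc n)) (⋆-identityʳ (θ a) n)))) ⟩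
        θ a (suc n) - + 4 * θ a n
          ∎
      via-assoc : (θ a ⋆ (s ⋆ s)) (suc n) ≡ + 2 * a n - a (suc n)
      via-assoc = begin
        (θ a ⋆ (s ⋆ s)) (suc n)                      ≡⟨ ⋆-assoc (θ a) s s (suc n) ⟨
        ((θ a ⋆ s) ⋆ s) (suc n)                      ≡⟨ ⋆-congˡ s θa⋆s (suc n) ⟩
        ((a ⊖ 𝟙) ⋆ s) (suc n)                        ≡⟨ ⋆-distribʳ-⊖ a 𝟙 s (suc n) ⟩
        (a ⋆ s) (suc n) - (𝟙 ⋆ s) (suc n)            ≡⟨ cong₂ _-_ (a⋆s (suc n)) (⋆-identityˡ s (suc n)) ⟩
        (+ 2 * 0ℤ - a (suc n)) - (0ℤ - + 2 * a n)    ≡⟨ ring (a n) (a (suc n)) ⟩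
        + 2 * a n - a (suc n)                        ∎
        where
        ring : ∀ A A′ → (+ 2 * 0ℤ - A′) - (0ℤ - + 2 * A) ≡ + 2 * A - A′
        ring = solve-∀

    ratio : ∀ n → (+ 2 + + n) * a (suc n) ≡ (+ 2 + + 4 * + n) * a n
    ratio n = begin
      (+ 2 + + n) * a (suc n)
        ≡⟨ ring₁ (+ n) (a n) (a (suc n)) ⟩
      (θ a (suc n) - + 4 * θ a n) + a (suc n) + + 4 * θ a n
        ≡⟨ cong (λ z → z + a (suc n) + + 4 * θ a n) (θa-recurrence n) ⟩
      (+ 2 * a n - a (suc n)) + a (suc n) + + 4 * θ a n
        ≡⟨ ring₂ (+ n) (a n) (a (suc n)) ⟩
      (+ 2 + + 4 * + n) * a n
        ∎
      where
      ring₁ : ∀ P A A′ → (+ 2 + P) * A′ ≡ ((1ℤ + P) * A′ - + 4 * (P * A)) + A′ + + 4 * (P * A)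
      ring₁ = solve-∀
      ring₂ : ∀ P A A′ → (+ 2 * A - A′) + A′ + + 4 * (P * A) ≡ (+ 2 + + 4 * P) * A
      ring₂ = solve-∀

open import Data.Nat
  using (ℕ; zero; suc; _+_; _*_; _∸_; _≤_; _<_; z≤n; s≤s; _/_; _!; _<?_; _≟_; _<ᵇ_)
open import Data.Nat.Properties
open import Data.Nat.Combinatorics using (_C_; k![n∸k]!∣n!)
open import Data.Nat.Combinatorics.Specification using (nCk≡n!/k![n-k]!)
open import Data.Nat.DivMod using (m*n/n≡m; m/n*n≡m)
import Data.Nat.Tactic.RingSolver as ℕ-Solver
import Data.Integer as ℤ
import Data.Integer.Properties as ℤ
import Data.Integer.Tactic.RingSolver as ℤ-Solver
open import Function using (_∘_; id; case_of_)
open import Data.Bool using (true; false; T)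
open import Relation.Binary.PropositionalEquality
  using (_≡_; _≢_; refl; sym; trans; cong; cong₂; subst; subst₂; _≗_; module ≡-Reasoning)

open import Data.List using (List; []; _∷_; [_]; _++_; length; map; filter; cartesianProduct; upTo)
import Data.List.Properties as List
open import Data.List.Membership.Propositional using (_∈_; _∉_; find; lose)
open import Data.List.Membership.DecPropositional _≟_ using (_∈?_)
open import Data.List.Membership.Propositional.Properties
  using (∈-++⁺ˡ; ∈-++⁺ʳ; ∈-++⁻; ∈-map⁺; ∈-map⁻; ∈-filter⁺; ∈-filter⁻; ∈-upTo⁺; ∈-upTo⁻; ∈-∃++;
         ∈-cartesianProduct⁺; ∈-cartesianProduct⁻)
open import Data.List.Membership.Propositional.Properties.WithK using (unique∧set⇒bag)
open import Data.List.Relation.Binary.BagAndSetEquality using (∼bag⇒↭)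
open import Data.List.Relation.Binary.Permutation.Propositional.Properties using (↭-length)
open import Data.List.Relation.Unary.Any using (Any; here; there; any?)
import Data.List.Relation.Unary.Any.Properties as Any
open import Data.List.Relation.Binary.Subset.Propositional using (_⊆_)
import Data.List.Relation.Binary.Subset.Propositional.Properties as ⊆
open import Data.List.Relation.Unary.All using (All; []; _∷_)
import Data.List.Relation.Unary.All as All
import Data.List.Relation.Unary.All.Properties as All
open import Data.List.Relation.Unary.AllPairs using ([]; _∷_)
open import Data.List.Relation.Unary.Unique.Propositional using (Unique)
import Data.List.Relation.Unary.Unique.Propositional.Properties as Unique
open import Data.Product using (_×_; _,_; proj₁; proj₂; ∃-syntax; Σ-syntax)
import Data.Product as Product
open import Data.Sum using (_⊎_; inj₁; inj₂; [_,_]′)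
import Data.Sum as Sum
open import Data.Empty using (⊥; ⊥-elim)
open import Data.Unit using (⊤)
open import Relation.Binary.Definitions using (Tri; tri<; tri≈; tri>)
open import Function.Bundles using (_⇔_; mk⇔; Equivalence)
open Equivalence using (to; from)
open import Relation.Nullary using (¬_; Dec; yes; no; ¬?; _×-dec_; _⊎-dec_)
open import Relation.Unary using (Decidable)

open import Data.Fin using (zero; suc; toℕ)
import Data.Fin.Properties as Fin
open import Data.Vec using (Vec; []; _∷_; lookup; removeAt; toList; fromList; cast)
import Data.Vec.Properties as Vec
open import Data.Vec.Membership.Propositional.Properties using (∈-toList⁺; ∈-lookup)
import Data.Vec.Relation.Unary.Any as VecAny
import Data.Vec.Relation.Unary.Any.Properties as VecAny
open import Data.Vec.Relation.Binary.Equality.Cast using (cast-is-id)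

open import Defs

open ≡-Reasoning

∑≤ : ℕ → (ℕ → ℕ) → ℕ
∑≤ zero    g = g 0
∑≤ (suc n) g = ∑≤ n g + g (suc n)

∑≤-cong : ∀ n {g h : ℕ → ℕ} → (∀ {i} → i ≤ n → g i ≡ h i) → ∑≤ n g ≡ ∑≤ n h
∑≤-cong zero    g≡h = g≡h z≤n
∑≤-cong (suc n) g≡h = cong₂ _+_ (∑≤-cong n (g≡h ∘ m≤n⇒m≤1+n)) (g≡h ≤-refl)

∑≤-distrib-+ : ∀ n (g h : ℕ → ℕ) → ∑≤ n (λ i → g i + h i) ≡ ∑≤ n g + ∑≤ n h
∑≤-distrib-+ zero    g h = refl
∑≤-distrib-+ (suc n) g h =
  trans (cong (_+ (g (suc n) + h (suc n))) (∑≤-distrib-+ n g h))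
        (interchange (∑≤ n g) (∑≤ n h) (g (suc n)) (h (suc n)))
  where
  interchange : ∀ a b c d → (a + b) + (c + d) ≡ (a + c) + (b + d)
  interchange = ℕ-Solver.solve-∀

∑≤-suc : ∀ n (g : ℕ → ℕ) → ∑≤ (suc n) g ≡ g 0 + ∑≤ n (g ∘ suc)
∑≤-suc zero    g = refl
∑≤-suc (suc n) g =
  trans (cong (_+ g (suc (suc n))) (∑≤-suc n g)) (+-assoc (g 0) _ _)

∑≤-reverse : ∀ n (g : ℕ → ℕ) → ∑≤ n g ≡ ∑≤ n (λ i → g (n ∸ i))
∑≤-reverse zero    g = refl
∑≤-reverse (suc n) g = begin
  ∑≤ n g + g (suc n)                   ≡⟨ +-comm (∑≤ n g) _ ⟩
  g (suc n) + ∑≤ n g                   ≡⟨ cong (g (suc n) +_) (∑≤-reverse n g) ⟩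
  g (suc n) + ∑≤ n (λ i → g (n ∸ i))   ≡⟨ ∑≤-suc n (λ i → g (suc n ∸ i)) ⟨
  ∑≤ (suc n) (λ i → g (suc n ∸ i))     ∎

∑≤-convolution-comm : ∀ n (g h : ℕ → ℕ) →
                      ∑≤ n (λ i → g i * h (n ∸ i)) ≡ ∑≤ n (λ i → h i * g (n ∸ i))
∑≤-convolution-comm n g h = trans (∑≤-reverse n _) (∑≤-cong n swap)
  where
  swap : ∀ {i} → i ≤ n → g (n ∸ i) * h (n ∸ (n ∸ i)) ≡ h i * g (n ∸ i)
  swap {i} i≤n = trans (cong (λ j → g (n ∸ i) * h j) (m∸[m∸n]≡n i≤n)) (*-comm (g (n ∸ i)) (h i))

pos-∑≤ : ∀ n (g : ℕ → ℕ) → ℤ.+ ∑≤ n g ≡ sumZ (ℤ.+_ ∘ g) n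
pos-∑≤ zero    g = refl
pos-∑≤ (suc n) g = trans (ℤ.pos-+ (∑≤ n g) _) (cong (ℤ._+ ℤ.+ g (suc n)) (pos-∑≤ n g))


open PowerSeries using (_⋆_; module Segner)

⋆-pos : ∀ (f g : ℕ → ℕ) n → ((ℤ.+_ ∘ f) ⋆ (ℤ.+_ ∘ g)) n ≡ ℤ.+ ∑≤ n (λ i → f i * g (n ∸ i))
⋆-pos f g zero    = sym (ℤ.pos-* (f 0) (g 0))
⋆-pos f g (suc n) = begin
  ℤ.+ f 0 ℤ.* ℤ.+ g (suc n) ℤ.+ ((ℤ.+_ ∘ f ∘ suc) ⋆ (ℤ.+_ ∘ g)) n
    ≡⟨ cong₂ ℤ._+_ (sym (ℤ.pos-* (f 0) (g (suc n)))) (⋆-pos (f ∘ suc) g n) ⟩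
  ℤ.+ (f 0 * g (suc n)) ℤ.+ ℤ.+ ∑≤ n (λ i → f (suc i) * g (n ∸ i))
    ≡⟨ ℤ.pos-+ (f 0 * g (suc n)) _ ⟨
  ℤ.+ (f 0 * g (suc n) + ∑≤ n (λ i → f (suc i) * g (n ∸ i)))
    ≡⟨ cong ℤ.+_ (∑≤-suc n (λ i → f i * g (suc n ∸ i))) ⟨
  ℤ.+ ∑≤ (suc n) (λ i → f i * g (suc n ∸ i))
    ∎

choose-factorials : ∀ {n k} → k ≤ n → (n C k) * (k ! * (n ∸ k) !) ≡ n !
choose-factorials {n} {k} k≤n =
  trans (cong (_* (k ! * (n ∸ k) !)) (nCk≡n!/k![n-k]! k≤n)) (m/n*n≡m (k![n∸k]!∣n! k≤n))
  where instance _ = k !* (n ∸ k) !≢0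

central : ℕ → ℕ
central m = (2 * m) C m

central-factorials : ∀ m → central m * (m ! * m !) ≡ (2 * m) !
central-factorials m =
  subst (λ j → central m * (m ! * j !) ≡ (2 * m) !) 2m∸m≡m (choose-factorials m≤2m)
  where
  2m≡m+m : 2 * m ≡ m + m
  2m≡m+m = cong (m +_) (+-comm m 0)
  2m∸m≡m : 2 * m ∸ m ≡ m
  2m∸m≡m = trans (cong (_∸ m) 2m≡m+m) (m+n∸m≡n m m)
  m≤2m : m ≤ 2 * m
  m≤2m = subst (m ≤_) (sym 2m≡m+m) (m≤m+n m m)

central-suc : ∀ m → suc m * central (suc m) ≡ (2 + 4 * m) * central m
central-suc m = *-cancelʳ-≡ _ _ (suc m * (m ! * m !)) (begin
  (suc m * central (suc m)) * (suc m * (m ! * m !))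
    ≡⟨ ring₁ m (central (suc m)) (m !) ⟩
  central (suc m) * (suc m ! * suc m !)
    ≡⟨ central-factorials (suc m) ⟩
  (2 * suc m) !
    ≡⟨ cong _! (ring₂ m) ⟩
  suc (suc (2 * m)) * (suc (2 * m) * (2 * m) !)
    ≡⟨ cong (λ z → suc (suc (2 * m)) * (suc (2 * m) * z)) (central-factorials m) ⟨
  suc (suc (2 * m)) * (suc (2 * m) * (central m * (m ! * m !)))
    ≡⟨ ring₃ m (central m) (m !) ⟩
  ((2 + 4 * m) * central m) * (suc m * (m ! * m !))
    ∎)
  where
  instance
    _ = m !* m !≢0
    _ = m*n≢0 (suc m) (m ! * m !)
  ring₁ : ∀ m B F → (suc m * B) * (suc m * (F * F)) ≡ B * ((suc m * F) * (suc m * F))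
  ring₁ = ℕ-Solver.solve-∀
  ring₂ : ∀ m → 2 * suc m ≡ suc (suc (2 * m))
  ring₂ = ℕ-Solver.solve-∀
  ring₃ : ∀ m B F → suc (suc (2 * m)) * (suc (2 * m) * (B * (F * F)))
                    ≡ ((2 + 4 * m) * B) * (suc m * (F * F))
  ring₃ = ℕ-Solver.solve-∀

segner⇒catalan : (c : ℕ → ℕ) → c 0 ≡ 1 → (∀ n → c (suc n) ≡ ∑≤ n (λ i → c i * c (n ∸ i))) →
                 ∀ n → c n ≡ catalan n
segner⇒catalan c c-zero c-suc n =
  trans (sym (m*n/n≡m (c n) (suc n))) (cong (_/ suc n) (trans (*-comm (c n) (suc n)) (closed n)))
  where
  open Segner (ℤ.+_ ∘ c) (cong ℤ.+_ c-zero) (λ n → trans (cong ℤ.+_ (c-suc n)) (sym (⋆-pos c c n)))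

  ratioℕ : ∀ n → (2 + n) * c (suc n) ≡ (2 + 4 * n) * c n
  ratioℕ n = ℤ.+-injective (begin
    ℤ.+ ((2 + n) * c (suc n))                     ≡⟨ ℤ.pos-* (2 + n) (c (suc n)) ⟩
    ℤ.+ (2 + n) ℤ.* ℤ.+ c (suc n)                 ≡⟨ ratio n ⟩
    (ℤ.+ 2 ℤ.+ ℤ.+ 4 ℤ.* ℤ.+ n) ℤ.* ℤ.+ c n       ≡⟨ cong (λ z → (ℤ.+ 2 ℤ.+ z) ℤ.* ℤ.+ c n) (ℤ.pos-* 4 n) ⟨
    ℤ.+ (2 + 4 * n) ℤ.* ℤ.+ c n                   ≡⟨ ℤ.pos-* (2 + 4 * n) (c n) ⟨
    ℤ.+ ((2 + 4 * n) * c n)                       ∎)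

  closed : ∀ n → suc n * c n ≡ central n
  closed zero    = cong (_+ 0) c-zero
  closed (suc n) = *-cancelˡ-≡ _ _ (suc n) (begin
    suc n * (suc (suc n) * c (suc n))   ≡⟨ cong (suc n *_) (ratioℕ n) ⟩
    suc n * ((2 + 4 * n) * c n)         ≡⟨ swap (suc n) (2 + 4 * n) (c n) ⟩
    (2 + 4 * n) * (suc n * c n)         ≡⟨ cong ((2 + 4 * n) *_) (closed n) ⟩
    (2 + 4 * n) * central n             ≡⟨ central-suc n ⟨
    suc n * central (suc n)             ∎)
    where
    swap : ∀ x y z → x * (y * z) ≡ y * (x * z)
    swap = ℕ-Solver.solve-∀

HasSize : {U : Set} → (U → Set) → ℕ → Set
HasSize {U} P a = ∃[ L ] (Unique L × ((x : U) → x ∈ L ⇔ P x) × length L ≡ a)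

module _ {U : Set} where

  size-unique : ∀ {P : U → Set} {a b} → HasSize P a → HasSize P b → a ≡ b
  size-unique (L , L! , L⇔ , refl) (M , M! , M⇔ , refl) =
    ↭-length (∼bag⇒↭ (unique∧set⇒bag L! M! (λ {x} → mk⇔ (from (M⇔ x) ∘ to (L⇔ x))
                                                        (from (L⇔ x) ∘ to (M⇔ x)))))

  size-cong : ∀ {P Q : U → Set} {a} → (∀ x → P x ⇔ Q x) → HasSize P a → HasSize Q a
  size-cong P⇔Q (L , L! , L⇔ , |L|) =
    L , L! , (λ x → mk⇔ (to (P⇔Q x) ∘ to (L⇔ x)) (from (L⇔ x) ∘ from (P⇔Q x))) , |L|

  size-empty : ∀ {P : U → Set} → (∀ x → ¬ P x) → HasSize P 0
  size-empty ¬P = [] , [] , (λ x → mk⇔ (λ ()) (⊥-elim ∘ ¬P x)) , refl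

  size-singleton : (y : U) → HasSize (_≡ y) 1
  size-singleton y = [ y ] , [] ∷ [] , (λ x → mk⇔ (λ { (here x≡y) → x≡y ; (there ()) }) here) , refl

  size-⊎ : ∀ {P Q : U → Set} {a b} → HasSize P a → HasSize Q b → (∀ x → P x → ¬ Q x) →
           HasSize (λ x → P x ⊎ Q x) (a + b)
  size-⊎ {P} {Q} (L , L! , L⇔ , refl) (M , M! , M⇔ , refl) disjoint =
    L ++ M ,
    Unique.++⁺ L! M! (λ (x∈L , x∈M) → disjoint _ (to (L⇔ _) x∈L) (to (M⇔ _) x∈M)) ,
    (λ x → mk⇔ (Sum.map (to (L⇔ x)) (to (M⇔ x)) ∘ ∈-++⁻ L)
               [ ∈-++⁺ˡ ∘ from (L⇔ x) , ∈-++⁺ʳ L ∘ from (M⇔ x) ]′) ,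
    List.length-++ L

  size-filter : ∀ {P Q : U → Set} {a} → HasSize P a → Decidable Q →
                ∃[ b ] ∃[ c ] (HasSize (λ x → P x × Q x) b × HasSize (λ x → P x × ¬ Q x) c × a ≡ b + c)
  size-filter {P} {Q} (L , L! , L⇔ , refl) Q? =
    _ , _ , part Q? , part (¬? ∘ Q?) , sym (length-filter-split L)
    where
    part : ∀ {R : U → Set} (R? : Decidable R) → HasSize (λ x → P x × R x) (length (filter R? L))
    part R? = filter R? L , Unique.filter⁺ R? L! ,
              (λ x → mk⇔ (Product.map₁ (to (L⇔ x)) ∘ ∈-filter⁻ R?)
                         (λ (px , rx) → ∈-filter⁺ R? (from (L⇔ x) px) rx)) ,
              refl
    length-filter-split : ∀ L → length (filter Q? L) + length (filter (¬? ∘ Q?) L) ≡ length L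
    length-filter-split []      = refl
    length-filter-split (x ∷ L) with Q? x
    ... | yes _ = cong suc (length-filter-split L)
    ... | no  _ = trans (+-suc _ _) (cong suc (length-filter-split L))

Unique-map⁺ : ∀ {A B : Set} (f : A → B) {xs} →
              (∀ {x y} → x ∈ xs → y ∈ xs → f x ≡ f y → x ≡ y) → Unique xs → Unique (map f xs)
Unique-map⁺ f             _   []           = []
Unique-map⁺ f {x ∷ xs} f-inj (x∉xs ∷ xs!) =
  All.map⁺ (All.tabulate (λ y∈xs fx≡fy → All.lookup x∉xs y∈xs (f-inj (here refl) (there y∈xs) fx≡fy))) ∷
  Unique-map⁺ f (λ x∈ y∈ → f-inj (there x∈) (there y∈)) xs!

size-image : ∀ {A B : Set} {P : A → Set} {a} (g : A → B) → HasSize P a →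
             (∀ x y → P x → P y → g x ≡ g y → x ≡ y) →
             HasSize (λ z → ∃[ x ] (P x × z ≡ g x)) a
size-image g (L , L! , L⇔ , refl) g-inj =
  map g L ,
  Unique-map⁺ g (λ x∈ y∈ → g-inj _ _ (to (L⇔ _) x∈) (to (L⇔ _) y∈)) L! ,
  (λ z → mk⇔ (λ z∈ → let (x , x∈ , z≡gx) = ∈-map⁻ g z∈ in x , to (L⇔ x) x∈ , z≡gx)
             (λ { (x , px , refl) → ∈-map⁺ g (from (L⇔ x) px) })) ,
  List.length-map g L

size-× : ∀ {A B : Set} {P : A → Set} {Q : B → Set} {a b} → HasSize P a → HasSize Q b →
         HasSize (λ (z : A × B) → P (proj₁ z) × Q (proj₂ z)) (a * b)
size-× (L , L! , L⇔ , refl) (M , M! , M⇔ , refl) =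
  cartesianProduct L M ,
  Unique.cartesianProduct⁺ L! M! ,
  (λ (x , y) → mk⇔ (Product.map (to (L⇔ x)) (to (M⇔ y)) ∘ ∈-cartesianProduct⁻ L M)
                   (λ (px , qy) → ∈-cartesianProduct⁺ (from (L⇔ x) px) (from (M⇔ y) qy))) ,
  length-cartesianProduct L
  where
  length-cartesianProduct : ∀ L → length (cartesianProduct L M) ≡ length L * length M
  length-cartesianProduct []      = refl
  length-cartesianProduct (x ∷ L) =
    trans (List.length-++ (map (x ,_) M)) (cong₂ _+_ (List.length-map (x ,_) M) (length-cartesianProduct L))

size-∃≤ : ∀ {U : Set} n (Q : ℕ → U → Set) (c : ℕ → ℕ) →
          (∀ {i} → i ≤ n → HasSize (Q i) (c i)) →
          (∀ {i j x} → i ≤ n → j ≤ n → Q i x → Q j x → i ≡ j) →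
          HasSize (λ x → ∃[ i ] (i ≤ n × Q i x)) (∑≤ n c)
size-∃≤ zero Q c size _ =
  size-cong (λ x → mk⇔ (λ q → 0 , z≤n , q) (λ { (0 , _ , q) → q })) (size z≤n)
size-∃≤ (suc n) Q c size index-unique =
  size-cong (λ x → mk⇔ [ (λ (i , i≤n , q) → i , m≤n⇒m≤1+n i≤n , q) , (λ q → suc n , ≤-refl , q) ]′
                       split)
    (size-⊎ (size-∃≤ n Q c (size ∘ m≤n⇒m≤1+n)
                     (λ i≤n j≤n → index-unique (m≤n⇒m≤1+n i≤n) (m≤n⇒m≤1+n j≤n)))
            (size ≤-refl)
            (λ x (i , i≤n , qi) qn → <-irrefl (index-unique (m≤n⇒m≤1+n i≤n) ≤-refl qi qn) (s≤s i≤n)))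
  where
  split : ∀ {x} → ∃[ i ] (i ≤ suc n × Q i x) → ∃[ i ] (i ≤ n × Q i x) ⊎ Q (suc n) x
  split (i , i≤1+n , q) with m≤n⇒m<n∨m≡n i≤1+n
  ... | inj₁ i<1+n = inj₁ (i , ≤-pred i<1+n , q)
  ... | inj₂ refl  = inj₂ q

-- Permutations are handled as lists of entries; a superscript ᴸ marks the list version of a
-- notion that Defs states for vectors.
Starts231 : ℕ → List ℕ → Set
Starts231 x []       = ⊥
Starts231 x (y ∷ ys) = (x < y × Any (_< x) ys) ⊎ Starts231 x ys

Contains231ᴸ : List ℕ → Set
Contains231ᴸ []       = ⊥
Contains231ᴸ (x ∷ xs) = Starts231 x xs ⊎ Contains231ᴸ xs

starts231? : ∀ x ys → Dec (Starts231 x ys)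
starts231? x []       = no λ ()
starts231? x (y ∷ ys) = ((x <? y) ×-dec any? (_<? x) ys) ⊎-dec starts231? x ys

contains231ᴸ? : Decidable Contains231ᴸ
contains231ᴸ? []       = no λ ()
contains231ᴸ? (x ∷ xs) = starts231? x xs ⊎-dec contains231ᴸ? xs

Below : List ℕ → List ℕ → Set
Below α γ = ∀ {a c} → a ∈ α → c ∈ γ → a < c

Bounded : List ℕ → ℕ → Set
Bounded xs m = ∀ {a} → a ∈ xs → a < m

¬Any<-above : ∀ {x q} → (∀ {c} → c ∈ q → x < c) → ¬ Any (_< x) q
¬Any<-above x<q some<x = let (c , c∈q , c<x) = find some<x in <-asym (x<q c∈q) c<x

¬Starts231-above : ∀ {x q} → (∀ {c} → c ∈ q → x < c) → ¬ Starts231 x q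
¬Starts231-above {q = y ∷ q} x<q (inj₁ (_ , some<x)) = ¬Any<-above (x<q ∘ there) some<x
¬Starts231-above {q = y ∷ q} x<q (inj₂ s)            = ¬Starts231-above (x<q ∘ there) s

¬Starts231-max : ∀ {m γ} → Bounded γ m → ¬ Starts231 m γ
¬Starts231-max {γ = y ∷ γ} γ<m (inj₁ (m<y , _)) = <-asym m<y (γ<m (here refl))
¬Starts231-max {γ = y ∷ γ} γ<m (inj₂ s)         = ¬Starts231-max (γ<m ∘ there) s

Starts231-++⁺ˡ : ∀ {x} p {q} → Starts231 x p → Starts231 x (p ++ q)
Starts231-++⁺ˡ (y ∷ p) (inj₁ (x<y , c<x)) = inj₁ (x<y , Any.++⁺ˡ c<x)
Starts231-++⁺ˡ (y ∷ p) (inj₂ s)           = inj₂ (Starts231-++⁺ˡ p s)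

Starts231-++⁺ʳ : ∀ {x} p {q} → Starts231 x q → Starts231 x (p ++ q)
Starts231-++⁺ʳ []      s = s
Starts231-++⁺ʳ (y ∷ p) s = inj₂ (Starts231-++⁺ʳ p s)

Starts231-++⁻ : ∀ {x} p {q} → (∀ {c} → c ∈ q → x < c) → Starts231 x (p ++ q) → Starts231 x p
Starts231-++⁻ []      x<q s                  = ⊥-elim (¬Starts231-above x<q s)
Starts231-++⁻ (y ∷ p) x<q (inj₁ (x<y , c<x)) =
  inj₁ (x<y , [ id , ⊥-elim ∘ ¬Any<-above x<q ]′ (Any.++⁻ p c<x))
Starts231-++⁻ (y ∷ p) x<q (inj₂ s)           = inj₂ (Starts231-++⁻ p x<q s)

Contains231ᴸ-++⁺ : ∀ α {γ} → Contains231ᴸ α ⊎ Contains231ᴸ γ → Contains231ᴸ (α ++ γ)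
Contains231ᴸ-++⁺ []      (inj₂ c)         = c
Contains231ᴸ-++⁺ (x ∷ α) (inj₁ (inj₁ s))  = inj₁ (Starts231-++⁺ˡ α s)
Contains231ᴸ-++⁺ (x ∷ α) (inj₁ (inj₂ c))  = inj₂ (Contains231ᴸ-++⁺ α (inj₁ c))
Contains231ᴸ-++⁺ (x ∷ α) (inj₂ c)         = inj₂ (Contains231ᴸ-++⁺ α (inj₂ c))

Contains231ᴸ-++⁻ : ∀ α {γ} → Below α γ → Contains231ᴸ (α ++ γ) → Contains231ᴸ α ⊎ Contains231ᴸ γ
Contains231ᴸ-++⁻ []      _   c        = inj₂ c
Contains231ᴸ-++⁻ (x ∷ α) α<γ (inj₁ s) = inj₁ (inj₁ (Starts231-++⁻ α (α<γ (here refl)) s))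
Contains231ᴸ-++⁻ (x ∷ α) α<γ (inj₂ c) =
  Sum.map₁ inj₂ (Contains231ᴸ-++⁻ α (λ a∈α c∈γ → α<γ (there a∈α) c∈γ) c)

record Stacked (α : List ℕ) (m : ℕ) (γ : List ℕ) : Set where
  field
    below : Below α γ
    α<m   : Bounded α m
    γ<m   : Bounded γ m
open Stacked

Stacked-⊆ : ∀ {α α′ m γ γ′} → α′ ⊆ α → γ′ ⊆ γ → Stacked α m γ → Stacked α′ m γ′
Stacked-⊆ α′⊆α γ′⊆γ st = record
  { below = λ a∈α′ c∈γ′ → below st (α′⊆α a∈α′) (γ′⊆γ c∈γ′)
  ; α<m   = α<m st ∘ α′⊆α
  ; γ<m   = γ<m st ∘ γ′⊆γ
  }

Contains231ᴸ-stacked⁺ : ∀ α {m γ} → Contains231ᴸ α ⊎ Contains231ᴸ γ → Contains231ᴸ (α ++ m ∷ γ)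
Contains231ᴸ-stacked⁺ α = Contains231ᴸ-++⁺ α ∘ Sum.map₂ inj₂

Contains231ᴸ-stacked⁻ : ∀ α {m γ} → Stacked α m γ →
                        Contains231ᴸ (α ++ m ∷ γ) → Contains231ᴸ α ⊎ Contains231ᴸ γ
Contains231ᴸ-stacked⁻ α {m} {γ} st =
  Sum.map₂ [ ⊥-elim ∘ ¬Starts231-max (γ<m st) , id ]′ ∘ Contains231ᴸ-++⁻ α α<mγ
  where
  α<mγ : Below α (m ∷ γ)
  α<mγ a∈α (here refl) = α<m st a∈α
  α<mγ a∈α (there c∈γ) = below st a∈α c∈γ

Contains231ᴸ-via-max : ∀ {a c m} α {γ} → a ∈ α → c ∈ γ → c < a → a < m →
                      Contains231ᴸ (α ++ m ∷ γ)
Contains231ᴸ-via-max (x ∷ α) (here refl) c∈γ c<a a<m =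
  inj₁ (Starts231-++⁺ʳ α (inj₁ (a<m , lose c∈γ c<a)))
Contains231ᴸ-via-max (x ∷ α) (there a∈α) c∈γ c<a a<m =
  inj₂ (Contains231ᴸ-via-max α a∈α c∈γ c<a a<m)

-- Unlike deleteEntry, this does not standardise: containing 231 depends only on relative order.
DeletionAvoids231 : List ℕ → Set
DeletionAvoids231 xs = ∃[ ys ] ∃[ w ] ∃[ zs ] (xs ≡ ys ++ w ∷ zs × ¬ Contains231ᴸ (ys ++ zs))

InAv231+1ᴸ : List ℕ → Set
InAv231+1ᴸ xs = ¬ Contains231ᴸ xs ⊎ DeletionAvoids231 xs

AlmostAvoids231 : List ℕ → Set
AlmostAvoids231 xs = Contains231ᴸ xs × DeletionAvoids231 xs

++-∷-split : ∀ α {m γ} ys {w zs} → α ++ m ∷ γ ≡ ys ++ w ∷ zs →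
             (Σ[ t ∈ List ℕ ] (α ≡ ys ++ w ∷ t × zs ≡ t ++ m ∷ γ))
             ⊎ (ys ≡ α × w ≡ m × zs ≡ γ)
             ⊎ (Σ[ t ∈ List ℕ ] (ys ≡ α ++ m ∷ t × γ ≡ t ++ w ∷ zs))
++-∷-split []      []       refl = inj₂ (inj₁ (refl , refl , refl))
++-∷-split []      (y ∷ ys) refl = inj₂ (inj₂ (ys , refl , refl))
++-∷-split (a ∷ α) []       refl = inj₁ (α , refl , refl)
++-∷-split (a ∷ α) (y ∷ ys) eq with ++-∷-split α ys (List.∷-injectiveʳ eq) | List.∷-injectiveˡ eq
... | inj₁ (t , refl , refl)          | refl = inj₁ (t , refl , refl)
... | inj₂ (inj₁ (refl , refl , refl)) | refl = inj₂ (inj₁ (refl , refl , refl))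
... | inj₂ (inj₂ (t , refl , refl))   | refl = inj₂ (inj₂ (t , refl , refl))

-- Each 231 lies inside α or inside γ, so deleting m destroys none of them, and the part that
-- keeps all its entries after the deletion must avoid 231.
AlmostAvoids231-stacked⁻ :
  ∀ α {m γ} → Stacked α m γ → AlmostAvoids231 (α ++ m ∷ γ) →
  (AlmostAvoids231 α × ¬ Contains231ᴸ γ) ⊎ (¬ Contains231ᴸ α × AlmostAvoids231 γ)
AlmostAvoids231-stacked⁻ α {m} {γ} st (c , ys , w , zs , eq , ¬c)
  with ++-∷-split α ys eq
... | inj₁ (t , refl , refl) =
  inj₁ ((cα , ys , w , t , refl , ¬c′ ∘ Contains231ᴸ-stacked⁺ (ys ++ t) ∘ inj₁) , ¬cγ)
  where
  ¬c′ : ¬ Contains231ᴸ ((ys ++ t) ++ m ∷ γ)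
  ¬c′ = ¬c ∘ subst Contains231ᴸ (List.++-assoc ys t (m ∷ γ))
  ¬cγ : ¬ Contains231ᴸ γ
  ¬cγ = ¬c′ ∘ Contains231ᴸ-stacked⁺ (ys ++ t) ∘ inj₂
  cα : Contains231ᴸ α
  cα = [ id , ⊥-elim ∘ ¬cγ ]′ (Contains231ᴸ-stacked⁻ α st c)
... | inj₂ (inj₁ (refl , refl , refl)) =
  ⊥-elim (¬c (Contains231ᴸ-++⁺ α (Contains231ᴸ-stacked⁻ α st c)))
... | inj₂ (inj₂ (t , refl , refl)) =
  inj₂ (¬cα , cγ , t , w , zs , refl , ¬c′ ∘ Contains231ᴸ-stacked⁺ α ∘ inj₂)
  where
  ¬c′ : ¬ Contains231ᴸ (α ++ m ∷ t ++ zs)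
  ¬c′ = ¬c ∘ subst Contains231ᴸ (sym (List.++-assoc α (m ∷ t) zs))
  ¬cα : ¬ Contains231ᴸ α
  ¬cα = ¬c′ ∘ Contains231ᴸ-stacked⁺ α ∘ inj₁
  cγ : Contains231ᴸ (t ++ w ∷ zs)
  cγ = [ ⊥-elim ∘ ¬cα , id ]′ (Contains231ᴸ-stacked⁻ α st c)

AlmostAvoids231-stacked⁺ :
  ∀ α {m γ} → Stacked α m γ →
  (AlmostAvoids231 α × ¬ Contains231ᴸ γ) ⊎ (¬ Contains231ᴸ α × AlmostAvoids231 γ) →
  AlmostAvoids231 (α ++ m ∷ γ)
AlmostAvoids231-stacked⁺ α {m} {γ} st (inj₁ ((cα , ys , w , t , refl , ¬c) , ¬cγ)) =
  Contains231ᴸ-stacked⁺ α (inj₁ cα) ,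
  ys , w , t ++ m ∷ γ , List.++-assoc ys (w ∷ t) (m ∷ γ) ,
  [ ¬c , ¬cγ ]′ ∘ Contains231ᴸ-stacked⁻ (ys ++ t) (Stacked-⊆ (⊆.++⁺ʳ ys (⊆.xs⊆x∷xs t w)) id st)
                ∘ subst Contains231ᴸ (sym (List.++-assoc ys t (m ∷ γ)))
AlmostAvoids231-stacked⁺ α {m} st (inj₂ (¬cα , cγ , t , w , zs , refl , ¬c)) =
  Contains231ᴸ-stacked⁺ α (inj₂ cγ) ,
  α ++ m ∷ t , w , zs , sym (List.++-assoc α (m ∷ t) (w ∷ zs)) ,
  [ ¬cα , ¬c ]′ ∘ Contains231ᴸ-stacked⁻ α (Stacked-⊆ id (⊆.++⁺ʳ t (⊆.xs⊆x∷xs zs w)) st)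
                ∘ subst Contains231ᴸ (List.++-assoc α (m ∷ t) zs)

map-≡-++-∷ : ∀ (g : ℕ → ℕ) β ys {w zs} → map g β ≡ ys ++ w ∷ zs →
             ∃[ ys′ ] ∃[ w′ ] ∃[ zs′ ] (β ≡ ys′ ++ w′ ∷ zs′ × ys ≡ map g ys′ × w ≡ g w′ × zs ≡ map g zs′)
map-≡-++-∷ g (b ∷ β) []       eq with List.∷-injective eq
... | refl , refl = [] , b , β , refl , refl , refl , refl
map-≡-++-∷ g (b ∷ β) (y ∷ ys) eq with List.∷-injective eq
... | refl , eq′ with map-≡-++-∷ g β ys eq′
... | ys′ , w′ , zs′ , refl , refl , refl , refl = b ∷ ys′ , w′ , zs′ , refl , refl , refl , refl

module OrderEmbedding (g : ℕ → ℕ) (Good : ℕ → Set)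
                      (g-<⇔ : ∀ {x y} → Good x → Good y → x < y ⇔ g x < g y) where

  private
    Any<-map⁺ : ∀ {x ys} → Good x → All Good ys → Any (_< x) ys → Any (_< g x) (map g ys)
    Any<-map⁺ gx (gy ∷ _)   (here y<x) = here (to (g-<⇔ gy gx) y<x)
    Any<-map⁺ gx (_ ∷ gys) (there y<x) = there (Any<-map⁺ gx gys y<x)

    Any<-map⁻ : ∀ {x ys} → Good x → All Good ys → Any (_< g x) (map g ys) → Any (_< x) ys
    Any<-map⁻ gx (gy ∷ _)   (here y<x) = here (from (g-<⇔ gy gx) y<x)
    Any<-map⁻ gx (_ ∷ gys) (there y<x) = there (Any<-map⁻ gx gys y<x)

    Starts231-map⁺ : ∀ {x ys} → Good x → All Good ys → Starts231 x ys → Starts231 (g x) (map g ys)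
    Starts231-map⁺ gx (gy ∷ gys) (inj₁ (x<y , c<x)) = inj₁ (to (g-<⇔ gx gy) x<y , Any<-map⁺ gx gys c<x)
    Starts231-map⁺ gx (_  ∷ gys) (inj₂ s)           = inj₂ (Starts231-map⁺ gx gys s)

    Starts231-map⁻ : ∀ {x ys} → Good x → All Good ys → Starts231 (g x) (map g ys) → Starts231 x ys
    Starts231-map⁻ gx (gy ∷ gys) (inj₁ (x<y , c<x)) = inj₁ (from (g-<⇔ gx gy) x<y , Any<-map⁻ gx gys c<x)
    Starts231-map⁻ gx (_  ∷ gys) (inj₂ s)           = inj₂ (Starts231-map⁻ gx gys s)

  Contains231ᴸ-map⁺ : ∀ {xs} → All Good xs → Contains231ᴸ xs → Contains231ᴸ (map g xs)
  Contains231ᴸ-map⁺ (gx ∷ gxs) (inj₁ s) = inj₁ (Starts231-map⁺ gx gxs s)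
  Contains231ᴸ-map⁺ (_  ∷ gxs) (inj₂ c) = inj₂ (Contains231ᴸ-map⁺ gxs c)

  Contains231ᴸ-map⁻ : ∀ {xs} → All Good xs → Contains231ᴸ (map g xs) → Contains231ᴸ xs
  Contains231ᴸ-map⁻ (gx ∷ gxs) (inj₁ s) = inj₁ (Starts231-map⁻ gx gxs s)
  Contains231ᴸ-map⁻ (_  ∷ gxs) (inj₂ c) = inj₂ (Contains231ᴸ-map⁻ gxs c)

  private
    All-delete : ∀ {P : ℕ → Set} ys {w zs} → All P (ys ++ w ∷ zs) → All P (ys ++ zs)
    All-delete ys = All.anti-mono (⊆.++⁺ʳ ys (⊆.xs⊆x∷xs _ _))

  DeletionAvoids231-map⁺ : ∀ {xs} → All Good xs → DeletionAvoids231 xs → DeletionAvoids231 (map g xs)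
  DeletionAvoids231-map⁺ good (ys , w , zs , refl , ¬c) =
    map g ys , g w , map g zs , List.map-++ g ys (w ∷ zs) ,
    ¬c ∘ Contains231ᴸ-map⁻ (All-delete ys good) ∘ subst Contains231ᴸ (sym (List.map-++ g ys zs))

  DeletionAvoids231-map⁻ : ∀ {xs} → All Good xs → DeletionAvoids231 (map g xs) → DeletionAvoids231 xs
  DeletionAvoids231-map⁻ {xs} good (ys , w , zs , eq , ¬c) with map-≡-++-∷ g xs ys eq
  ... | ys′ , w′ , zs′ , refl , refl , refl , refl =
    ys′ , w′ , zs′ , refl ,
    ¬c ∘ subst Contains231ᴸ (List.map-++ g ys′ zs′) ∘ Contains231ᴸ-map⁺ (All-delete ys′ good)

  AlmostAvoids231-map⁺ : ∀ {xs} → All Good xs → AlmostAvoids231 xs → AlmostAvoids231 (map g xs)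
  AlmostAvoids231-map⁺ good = Product.map (Contains231ᴸ-map⁺ good) (DeletionAvoids231-map⁺ good)

  AlmostAvoids231-map⁻ : ∀ {xs} → All Good xs → AlmostAvoids231 (map g xs) → AlmostAvoids231 xs
  AlmostAvoids231-map⁻ good = Product.map (Contains231ᴸ-map⁻ good) (DeletionAvoids231-map⁻ good)

record IsPermᴸ (n : ℕ) (xs : List ℕ) : Set where
  field
    length≡ : length xs ≡ n
    bounded : Bounded xs n
    unique  : Unique xs
open IsPermᴸ

module _ {A : Set} where

  remove : ∀ {x : A} {ys} → x ∈ ys → List A
  remove {ys = _ ∷ ys} (here _)    = ys
  remove {ys = y ∷ _}  (there x∈) = y ∷ remove x∈

  length-remove : ∀ {x : A} {ys} (x∈ys : x ∈ ys) → length ys ≡ suc (length (remove x∈ys))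
  length-remove (here _)    = refl
  length-remove (there x∈) = cong suc (length-remove x∈)

  ∈-remove : ∀ {x z : A} {ys} (x∈ys : x ∈ ys) → z ∈ ys → z ≢ x → z ∈ remove x∈ys
  ∈-remove (here refl) (here refl)  z≢x = ⊥-elim (z≢x refl)
  ∈-remove (here refl) (there z∈)  _   = z∈
  ∈-remove (there x∈)  (here refl) _   = here refl
  ∈-remove (there x∈)  (there z∈)  z≢x = there (∈-remove x∈ z∈ z≢x)

  Unique-⊆⇒length≤ : ∀ {xs ys : List A} → Unique xs → xs ⊆ ys → length xs ≤ length ys
  Unique-⊆⇒length≤ {[]}     _            _     = z≤n
  Unique-⊆⇒length≤ {x ∷ xs} (x∉xs ∷ xs!) xs⊆ys =
    subst (suc (length xs) ≤_) (sym (length-remove (xs⊆ys (here refl))))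
      (s≤s (Unique-⊆⇒length≤ xs! λ z∈xs →
              ∈-remove (xs⊆ys (here refl)) (xs⊆ys (there z∈xs)) (All.lookup x∉xs z∈xs ∘ sym)))

  Unique-++⁻ : ∀ (α : List A) {γ} → Unique (α ++ γ) → Unique α × Unique γ × (∀ {x} → x ∈ α → x ∉ γ)
  Unique-++⁻ []      γ!             = [] , γ! , λ ()
  Unique-++⁻ (x ∷ α) (x∉α++γ ∷ α++γ!) =
    let (α! , γ! , disjoint) = Unique-++⁻ α α++γ! in
    All.++⁻ˡ α x∉α++γ ∷ α! , γ! ,
    λ { (here refl) x∈γ → All.lookup (All.++⁻ʳ α x∉α++γ) x∈γ refl ; (there a∈α) → disjoint a∈α }

Unique-Bounded⇒length≤ : ∀ {xs k} → Unique xs → Bounded xs k → length xs ≤ k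
Unique-Bounded⇒length≤ {k = k} xs! xs<k =
  subst (_ ≤_) (List.length-upTo k) (Unique-⊆⇒length≤ xs! (∈-upTo⁺ ∘ xs<k))

-- Otherwise v ∷ xs would be k + 1 distinct values below k.
IsPermᴸ-∈ : ∀ {k xs v} → IsPermᴸ k xs → v < k → v ∈ xs
IsPermᴸ-∈ {k} {xs} {v} perm v<k with v ∈? xs
... | yes v∈xs = v∈xs
... | no  v∉xs = ⊥-elim (<-irrefl (length≡ perm) (Unique-Bounded⇒length≤ v∷xs! v∷xs<k))
  where
  v∷xs! : Unique (v ∷ xs)
  v∷xs! = All.tabulate (λ x∈xs v≡x → v∉xs (subst (_∈ xs) (sym v≡x) x∈xs)) ∷ unique perm
  v∷xs<k : Bounded (v ∷ xs) k
  v∷xs<k (here refl)  = v<k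
  v∷xs<k (there x∈xs) = bounded perm x∈xs

glue : ℕ → ℕ → List ℕ × List ℕ → List ℕ
glue i n (α , β) = α ++ n ∷ map (i +_) β

module SplitAtMax {n} (α γ : List ℕ) (perm : IsPermᴸ (suc n) (α ++ n ∷ γ)) (α<γ : Below α γ) where

  i : ℕ
  i = length α

  private
    α! : Unique α
    α! = proj₁ (Unique-++⁻ α (unique perm))

    n∉α : n ∉ α
    n∉α n∈α = proj₂ (proj₂ (Unique-++⁻ α (unique perm))) n∈α (here refl)

    n∉γ : n ∉ γ
    n∉γ with Unique-++⁻ α (unique perm)
    ... | _ , n∉γ ∷ _ , _ = λ n∈γ → All.lookup n∉γ n∈γ refl

  stacked : Stacked α n γ
  stacked = record
    { below = α<γ
    ; α<m   = λ a∈α → ≤∧≢⇒< (≤-pred (bounded perm (∈-++⁺ˡ a∈α))) λ { refl → n∉α a∈α }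
    ; γ<m   = λ c∈γ → ≤∧≢⇒< (≤-pred (bounded perm (∈-++⁺ʳ α (there c∈γ)))) λ { refl → n∉γ c∈γ }
    }

  α-perm : IsPermᴸ i α
  α-perm = record { length≡ = refl ; bounded = α<i ; unique = α! }
    where
    α<i : Bounded α i
    α<i {a} a∈α =
      subst (_≤ i) (List.length-upTo (suc a)) (Unique-⊆⇒length≤ (Unique.upTo⁺ (suc a)) upTo⊆α)
      where
      upTo⊆α : upTo (suc a) ⊆ α
      upTo⊆α {v} v∈ with v≤a ← ≤-pred (∈-upTo⁻ v∈)
                        | ∈-++⁻ α (IsPermᴸ-∈ perm (s≤s (≤-trans v≤a (<⇒≤ (α<m stacked a∈α)))))
      ... | inj₁ v∈α         = v∈α
      ... | inj₂ (here refl) = ⊥-elim (<-irrefl refl (≤-<-trans v≤a (α<m stacked a∈α)))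
      ... | inj₂ (there v∈γ) = ⊥-elim (<-irrefl refl (<-≤-trans (α<γ a∈α v∈γ) v≤a))

  i≤γ : ∀ {c} → c ∈ γ → i ≤ c
  i≤γ {c} c∈γ =
    subst (i ≤_) (List.length-upTo c) (Unique-⊆⇒length≤ α! (λ a∈α → ∈-upTo⁺ (α<γ a∈α c∈γ)))

  i+|γ|≡n : i + length γ ≡ n
  i+|γ|≡n = suc-injective (begin
    suc (i + length γ)     ≡⟨ +-suc i (length γ) ⟨
    i + length (n ∷ γ)     ≡⟨ List.length-++ α ⟨
    length (α ++ n ∷ γ)    ≡⟨ length≡ perm ⟩
    suc n                  ∎)

  i≤n : i ≤ n
  i≤n = subst (i ≤_) i+|γ|≡n (m≤m+n i (length γ))

  β : List ℕ
  β = map (_∸ i) γ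

  β-perm : IsPermᴸ (n ∸ i) β
  β-perm = record
    { length≡ = trans (List.length-map (_∸ i) γ)
                      (trans (sym (m+n∸m≡n i (length γ))) (cong (_∸ i) i+|γ|≡n))
    ; bounded = λ b∈β → let (c , c∈γ , b≡c∸i) = ∈-map⁻ (_∸ i) b∈β in
                        subst (_< n ∸ i) (sym b≡c∸i) (∸-monoˡ-< (γ<m stacked c∈γ) (i≤γ c∈γ))
    ; unique  = Unique-map⁺ (_∸ i) (λ c∈γ c′∈γ c∸i≡c′∸i →
                  trans (sym (m∸n+n≡m (i≤γ c∈γ)))
                        (trans (cong (_+ i) c∸i≡c′∸i) (m∸n+n≡m (i≤γ c′∈γ))))
                  γ!
    }
    where
    γ! : Unique γ
    γ! with Unique-++⁻ α (unique perm)
    ... | _ , _ ∷ γ! , _ = γ!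

  γ≡shifted-β : γ ≡ map (i +_) β
  γ≡shifted-β = sym (trans (sym (List.map-∘ γ)) (List.map-id-local (All.tabulate (m+[n∸m]≡n ∘ i≤γ))))

glue-perm : ∀ {n i α β} → i ≤ n → IsPermᴸ i α → IsPermᴸ (n ∸ i) β →
            IsPermᴸ (suc n) (glue i n (α , β)) × Stacked α n (map (i +_) β)
glue-perm {n} {i} {α} {β} i≤n α-perm β-perm = perm , stacked
  where
  γ = map (i +_) β

  i≤γ : ∀ {c} → c ∈ γ → i ≤ c
  i≤γ c∈γ with b , _ , refl ← ∈-map⁻ (i +_) c∈γ = m≤m+n i b

  stacked : Stacked α n γ
  stacked = record
    { below = λ a∈α c∈γ → <-≤-trans (bounded α-perm a∈α) (i≤γ c∈γ)
    ; α<m   = λ a∈α → <-≤-trans (bounded α-perm a∈α) i≤n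
    ; γ<m   = λ c∈γ → let (b , b∈β , c≡i+b) = ∈-map⁻ (i +_) c∈γ in
                      subst (_< n) (sym c≡i+b)
                            (subst (i + b <_) (m+[n∸m]≡n i≤n) (+-monoʳ-< i (bounded β-perm b∈β)))
    }

  perm : IsPermᴸ (suc n) (α ++ n ∷ γ)
  perm = record
    { length≡ = begin
        length (α ++ n ∷ γ)        ≡⟨ List.length-++ α ⟩
        length α + suc (length γ)  ≡⟨ cong₂ (λ a b → a + suc b) (length≡ α-perm)
                                            (trans (List.length-map (i +_) β) (length≡ β-perm)) ⟩
        i + suc (n ∸ i)            ≡⟨ +-suc i (n ∸ i) ⟩
        suc (i + (n ∸ i))          ≡⟨ cong suc (m+[n∸m]≡n i≤n) ⟩
        suc n                      ∎
    ; bounded = λ x∈ → [ m≤n⇒m≤1+n ∘ α<m stacked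
                       , (λ { (here refl) → ≤-refl ; (there c∈γ) → m≤n⇒m≤1+n (γ<m stacked c∈γ) }) ]′
                       (∈-++⁻ α x∈)
    ; unique  = Unique.++⁺ (unique α-perm)
                  (All.tabulate (λ c∈γ n≡c → <-irrefl (sym n≡c) (γ<m stacked c∈γ))
                   ∷ Unique.map⁺ (+-cancelˡ-≡ i _ _) (unique β-perm))
                  λ { (a∈α , here refl)  → <-irrefl refl (α<m stacked a∈α)
                    ; (a∈α , there c∈γ) → <-irrefl refl (below stacked a∈α c∈γ) }
    }

++-cancel-length : ∀ {A : Set} (xs xs′ : List A) {ys ys′} →
                   length xs ≡ length xs′ → xs ++ ys ≡ xs′ ++ ys′ → xs ≡ xs′ × ys ≡ ys′
++-cancel-length []       []         _   eq = refl , eq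
++-cancel-length (x ∷ xs) (x′ ∷ xs′) len eq with List.∷-injective eq
... | refl , eq′ = Product.map₁ (cong (x ∷_)) (++-cancel-length xs xs′ (suc-injective len) eq′)

max-position-unique : ∀ {n : ℕ} (α α′ : List ℕ) {γ γ′} → n ∉ α → n ∉ α′ →
                      α ++ n ∷ γ ≡ α′ ++ n ∷ γ′ → length α ≡ length α′
max-position-unique []      []       _    _    _  = refl
max-position-unique []      (_ ∷ _)  _    n∉α′ eq = ⊥-elim (n∉α′ (here (List.∷-injectiveˡ eq)))
max-position-unique (_ ∷ _) []       n∉α  _    eq = ⊥-elim (n∉α (here (sym (List.∷-injectiveˡ eq))))
max-position-unique (_ ∷ α) (_ ∷ α′) n∉α  n∉α′ eq =
  cong suc (max-position-unique α α′ (n∉α ∘ there) (n∉α′ ∘ there) (List.∷-injectiveʳ eq))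

module Shift (i : ℕ) = OrderEmbedding (i +_) (λ _ → ⊤) (λ _ _ → mk⇔ (+-monoʳ-< i) (+-cancelˡ-< i _ _))

Contains231ᴸ-shift : ∀ i β → Contains231ᴸ (map (i +_) β) ⇔ Contains231ᴸ β
Contains231ᴸ-shift i β =
  mk⇔ (Shift.Contains231ᴸ-map⁻ i (All.universal _ β)) (Shift.Contains231ᴸ-map⁺ i (All.universal _ β))

AlmostAvoids231-shift : ∀ i β → AlmostAvoids231 (map (i +_) β) ⇔ AlmostAvoids231 β
AlmostAvoids231-shift i β =
  mk⇔ (Shift.AlmostAvoids231-map⁻ i (All.universal _ β)) (Shift.AlmostAvoids231-map⁺ i (All.universal _ β))

Av : ℕ → List ℕ → Set
Av n xs = IsPermᴸ n xs × ¬ Contains231ᴸ xs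

AlmostAv : ℕ → List ℕ → Set
AlmostAv n xs = IsPermᴸ n xs × AlmostAvoids231 xs

Glued : (List ℕ → Set) → (List ℕ → Set) → ℕ → ℕ → List ℕ → Set
Glued P Q i n xs = ∃[ p ] ((P (proj₁ p) × Q (proj₂ p)) × xs ≡ glue i n p)

Glued-size : ∀ {P Q : List ℕ → Set} {i n a b} → (∀ {xs} → P xs → IsPermᴸ i xs) →
             HasSize P a → HasSize Q b → HasSize (Glued P Q i n) (a * b)
Glued-size {P} {Q} {i} {n} P⇒perm sizeP sizeQ =
  size-image (glue i n) (size-× sizeP sizeQ) glue-injective
  where
  glue-injective : ∀ p p′ → P (proj₁ p) × Q (proj₂ p) → P (proj₁ p′) × Q (proj₂ p′) →
                   glue i n p ≡ glue i n p′ → p ≡ p′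
  glue-injective (α , β) (α′ , β′) (pα , _) (pα′ , _) eq
    with refl , eq′ ← ++-cancel-length α α′ (trans (length≡ (P⇒perm pα)) (sym (length≡ (P⇒perm pα′))))
                                        eq =
    cong (α ,_) (List.map-injective (+-cancelˡ-≡ i _ _) (List.∷-injectiveʳ eq′))

Glued-index-unique : ∀ {P Q P′ Q′ : List ℕ → Set} {i j n xs} →
                     (∀ {xs} → P xs → IsPermᴸ i xs) → (∀ {xs} → P′ xs → IsPermᴸ j xs) → i ≤ n → j ≤ n →
                     Glued P Q i n xs → Glued P′ Q′ j n xs → i ≡ j
Glued-index-unique P⇒perm P′⇒perm i≤n j≤n ((α , _) , (pα , _) , refl) ((α′ , _) , (pα′ , _) , eq) =
  trans (sym (length≡ (P⇒perm pα)))
        (trans (max-position-unique α α′ (below-n (P⇒perm pα) i≤n) (below-n (P′⇒perm pα′) j≤n) eq)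
               (length≡ (P′⇒perm pα′)))
  where
  below-n : ∀ {k n α} → IsPermᴸ k α → k ≤ n → n ∉ α
  below-n α-perm k≤n n∈α = <-irrefl refl (<-≤-trans (bounded α-perm n∈α) k≤n)

split-at-max : ∀ {n xs} → IsPermᴸ (suc n) xs → ∃[ α ] ∃[ γ ] (xs ≡ α ++ n ∷ γ)
split-at-max perm = ∈-∃++ (IsPermᴸ-∈ perm ≤-refl)

¬Contains231ᴸ⇒Below : ∀ {n} α γ → IsPermᴸ (suc n) (α ++ n ∷ γ) →
                       ¬ Contains231ᴸ (α ++ n ∷ γ) → Below α γ
¬Contains231ᴸ⇒Below {n} α γ perm ¬c {a} {c} a∈α c∈γ = compare (<-cmp a c)
  where
  α∩nγ : ∀ {x} → x ∈ α → x ∉ n ∷ γ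
  α∩nγ = proj₂ (proj₂ (Unique-++⁻ α (unique perm)))

  compare : Tri (a < c) (a ≡ c) (c < a) → a < c
  compare (tri< a<c _ _) = a<c
  compare (tri≈ _ a≡c _) = ⊥-elim (α∩nγ a∈α (there (subst (_∈ γ) (sym a≡c) c∈γ)))
  compare (tri> _ _ c<a) =
    ⊥-elim (¬c (Contains231ᴸ-via-max α a∈α c∈γ c<a
                  (≤∧≢⇒< (≤-pred (bounded perm (∈-++⁺ˡ a∈α))) λ { refl → α∩nγ a∈α (here refl) })))

Av-suc⁻ : ∀ {n xs} → Av (suc n) xs → ∃[ i ] (i ≤ n × Glued (Av i) (Av (n ∸ i)) i n xs)
Av-suc⁻ {n} (perm , ¬c) with split-at-max perm
... | α , γ , refl =
  S.i , S.i≤n , (α , S.β) ,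
  ((S.α-perm , ¬c ∘ Contains231ᴸ-stacked⁺ α ∘ inj₁) ,
   (S.β-perm , ¬c ∘ Contains231ᴸ-stacked⁺ α ∘ inj₂ ∘ subst Contains231ᴸ (sym S.γ≡shifted-β)
                  ∘ from (Contains231ᴸ-shift S.i S.β))) ,
  cong (λ γ → α ++ n ∷ γ) S.γ≡shifted-β
  where module S = SplitAtMax α γ perm (¬Contains231ᴸ⇒Below α γ perm ¬c)

Av-suc⁺ : ∀ {n xs} → ∃[ i ] (i ≤ n × Glued (Av i) (Av (n ∸ i)) i n xs) → Av (suc n) xs
Av-suc⁺ (i , i≤n , (α , β) , ((α-perm , ¬cα) , (β-perm , ¬cβ)) , refl) =
  let (perm , stacked) = glue-perm i≤n α-perm β-perm in
  perm , [ ¬cα , ¬cβ ∘ to (Contains231ᴸ-shift i β) ]′ ∘ Contains231ᴸ-stacked⁻ α stacked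

MaxStacked : ℕ → List ℕ → Set
MaxStacked n xs = ∃[ α ] ∃[ γ ] (xs ≡ α ++ n ∷ γ × Below α γ)

Targetᴸ : ℕ → List ℕ → Set
Targetᴸ n xs = IsPermᴸ (suc n) xs × AlmostAvoids231 xs × MaxStacked n xs

TargetPiece : ℕ → ℕ → List ℕ → Set
TargetPiece n i xs = Glued (AlmostAv i) (Av (n ∸ i)) i n xs ⊎ Glued (Av i) (AlmostAv (n ∸ i)) i n xs

Targetᴸ⁻ : ∀ {n xs} → Targetᴸ n xs → ∃[ i ] (i ≤ n × TargetPiece n i xs)
Targetᴸ⁻ {n} (perm , almost , α , γ , refl , α<γ) =
  S.i , S.i≤n , Sum.map glue₁ glue₂ (AlmostAvoids231-stacked⁻ α S.stacked almost)
  where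
  module S = SplitAtMax α γ perm α<γ

  glued : α ++ n ∷ γ ≡ glue S.i n (α , S.β)
  glued = cong (λ γ → α ++ n ∷ γ) S.γ≡shifted-β

  glue₁ : AlmostAvoids231 α × ¬ Contains231ᴸ γ → Glued (AlmostAv S.i) (Av (n ∸ S.i)) S.i n (α ++ n ∷ γ)
  glue₁ (aα , ¬cγ) =
    (α , S.β) ,
    ((S.α-perm , aα) ,
     (S.β-perm , ¬cγ ∘ subst Contains231ᴸ (sym S.γ≡shifted-β) ∘ from (Contains231ᴸ-shift S.i S.β))) ,
    glued

  glue₂ : ¬ Contains231ᴸ α × AlmostAvoids231 γ → Glued (Av S.i) (AlmostAv (n ∸ S.i)) S.i n (α ++ n ∷ γ)
  glue₂ (¬cα , aγ) =
    (α , S.β) ,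
    ((S.α-perm , ¬cα) ,
     (S.β-perm , to (AlmostAvoids231-shift S.i S.β) (subst AlmostAvoids231 S.γ≡shifted-β aγ))) ,
    glued

Targetᴸ⁺ : ∀ {n xs} → ∃[ i ] (i ≤ n × TargetPiece n i xs) → Targetᴸ n xs
Targetᴸ⁺ (i , i≤n , inj₁ ((α , β) , ((α-perm , aα) , (β-perm , ¬cβ)) , refl)) =
  let (perm , stacked) = glue-perm i≤n α-perm β-perm in
  perm ,
  AlmostAvoids231-stacked⁺ α stacked (inj₁ (aα , ¬cβ ∘ to (Contains231ᴸ-shift i β))) ,
  α , map (i +_) β , refl , below stacked
Targetᴸ⁺ (i , i≤n , inj₂ ((α , β) , ((α-perm , ¬cα) , (β-perm , aβ)) , refl)) =
  let (perm , stacked) = glue-perm i≤n α-perm β-perm in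
  perm ,
  AlmostAvoids231-stacked⁺ α stacked (inj₂ (¬cα , from (AlmostAvoids231-shift i β) aβ)) ,
  α , map (i +_) β , refl , below stacked

Av-size-zero : HasSize (Av 0) 1
Av-size-zero = size-cong (λ xs → mk⇔ (λ { refl → empty-perm , λ () }) (empty ∘ length≡ ∘ proj₁))
                         (size-singleton [])
  where
  empty-perm : IsPermᴸ 0 []
  empty-perm = record { length≡ = refl ; bounded = λ () ; unique = [] }
  empty : ∀ {xs : List ℕ} → length xs ≡ 0 → xs ≡ []
  empty {[]} _ = refl

Av-size-suc : ∀ n (c : ℕ → ℕ) → (∀ {i} → i ≤ n → HasSize (Av i) (c i)) →
              HasSize (Av (suc n)) (∑≤ n (λ i → c i * c (n ∸ i)))
Av-size-suc n c size-Av =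
  size-cong (λ _ → mk⇔ Av-suc⁺ Av-suc⁻)
    (size-∃≤ n (λ i → Glued (Av i) (Av (n ∸ i)) i n) (λ i → c i * c (n ∸ i))
             (λ {i} i≤n → Glued-size proj₁ (size-Av i≤n) (size-Av (m∸n≤m n i)))
             (Glued-index-unique proj₁ proj₁))

Targetᴸ-size : ∀ n (c d : ℕ → ℕ) →
               (∀ {i} → i ≤ n → HasSize (Av i) (c i)) → (∀ {i} → i ≤ n → HasSize (AlmostAv i) (d i)) →
               HasSize (Targetᴸ n) (∑≤ n (λ i → d i * c (n ∸ i) + c i * d (n ∸ i)))
Targetᴸ-size n c d size-Av size-AlmostAv =
  size-cong (λ _ → mk⇔ Targetᴸ⁺ Targetᴸ⁻)
    (size-∃≤ n (TargetPiece n) (λ i → d i * c (n ∸ i) + c i * d (n ∸ i))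
             (λ {i} i≤n → size-⊎ (Glued-size proj₁ (size-AlmostAv i≤n) (size-Av (m∸n≤m n i)))
                                 (Glued-size proj₁ (size-Av i≤n) (size-AlmostAv (m∸n≤m n i)))
                                 (λ _ → disjoint))
             (λ i≤n j≤n g g′ → Glued-index-unique id id i≤n j≤n (forget g) (forget g′)))
  where
  forget : ∀ {i xs} → TargetPiece n i xs → Glued (IsPermᴸ i) (λ _ → ⊤) i n xs
  forget = [ (λ (p , ((α-perm , _) , _) , eq) → p , (α-perm , _) , eq)
           , (λ (p , ((α-perm , _) , _) , eq) → p , (α-perm , _) , eq) ]′

  disjoint : ∀ {i xs} → Glued (AlmostAv i) (Av (n ∸ i)) i n xs → ¬ Glued (Av i) (AlmostAv (n ∸ i)) i n xs
  disjoint ((α , _) , ((α-perm , (cα , _)) , _) , refl) ((α′ , _) , ((α′-perm , ¬cα′) , _) , eq)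
    with refl , _ ← ++-cancel-length α α′ (trans (length≡ α-perm) (sym (length≡ α′-perm))) eq = ¬cα′ cα

toList-injective′ : ∀ {m} (v w : Vec ℕ m) → toList v ≡ toList w → v ≡ w
toList-injective′ v w eq = trans (sym (cast-is-id refl v)) (Vec.toList-injective refl v w eq)

list⇒vec : ∀ {m} (xs : List ℕ) → length xs ≡ m → Σ[ v ∈ Vec ℕ m ] toList v ≡ xs
list⇒vec xs |xs|≡m =
  cast |xs|≡m (fromList xs) , trans (Vec.toList-cast |xs|≡m (fromList xs)) (Vec.toList∘fromList xs)

size-toList : ∀ {m a} {P : Vec ℕ m → Set} {Q : List ℕ → Set} → (∀ v → P v ⇔ Q (toList v)) →
              (∀ {xs} → Q xs → length xs ≡ m) → HasSize P a → HasSize Q a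
size-toList {Q = Q} P⇔Q Q⇒length sizeP =
  size-cong (λ xs → mk⇔ (λ { (v , pv , refl) → to (P⇔Q v) pv })
                        (λ qxs → let (v , v≡xs) = list⇒vec xs (Q⇒length qxs) in
                                 v , from (P⇔Q v) (subst Q (sym v≡xs) qxs) , sym v≡xs))
            (size-image toList sizeP (λ v w _ _ → toList-injective′ v w))

lookup-∈ : ∀ {m} (v : Vec ℕ m) i → lookup v i ∈ toList v
lookup-∈ v i = ∈-toList⁺ (∈-lookup i v)

Any-toList⇒lookup : ∀ {m} {P : ℕ → Set} (v : Vec ℕ m) → Any P (toList v) → ∃[ i ] P (lookup v i)
Any-toList⇒lookup v p = VecAny.index (VecAny.toList⁻ p) , VecAny.lookup-index (VecAny.toList⁻ p)

Unique⇒lookup-injective : ∀ {m} (v : Vec ℕ m) → Unique (toList v) →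
                          ∀ i j → lookup v i ≡ lookup v j → i ≡ j
Unique⇒lookup-injective (x ∷ v) _          zero    zero    _  = refl
Unique⇒lookup-injective (x ∷ v) (x∉v ∷ _)  zero    (suc j) eq =
  ⊥-elim (All.lookup x∉v (lookup-∈ v j) eq)
Unique⇒lookup-injective (x ∷ v) (x∉v ∷ _)  (suc i) zero    eq =
  ⊥-elim (All.lookup x∉v (lookup-∈ v i) (sym eq))
Unique⇒lookup-injective (x ∷ v) (_ ∷ v!)   (suc i) (suc j) eq =
  cong suc (Unique⇒lookup-injective v v! i j eq)

lookup-injective⇒Unique : ∀ {m} (v : Vec ℕ m) → (∀ i j → lookup v i ≡ lookup v j → i ≡ j) →
                          Unique (toList v)
lookup-injective⇒Unique []      _   = []
lookup-injective⇒Unique (x ∷ v) inj =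
  All.tabulate (λ y∈v x≡y → let (j , y≡vj) = Any-toList⇒lookup v y∈v in
                            Fin.0≢1+n (inj zero (suc j) (trans x≡y y≡vj))) ∷
  lookup-injective⇒Unique v (λ i j eq → Fin.suc-injective (inj (suc i) (suc j) eq))

IsPerm⇔IsPermᴸ : ∀ {m} (v : Vec ℕ m) → IsPerm v ⇔ IsPermᴸ m (toList v)
IsPerm⇔IsPermᴸ {m} v = mk⇔
  (λ (v<m , inj) → record
    { length≡ = Vec.length-toList v
    ; bounded = λ x∈v → let (i , x≡vi) = Any-toList⇒lookup v x∈v in subst (_< m) (sym x≡vi) (v<m i)
    ; unique  = lookup-injective⇒Unique v inj
    })
  (λ perm → bounded perm ∘ lookup-∈ v , Unique⇒lookup-injective v (unique perm))

Contains231⇔Contains231ᴸ : ∀ {m} (v : Vec ℕ m) → Contains231 v ⇔ Contains231ᴸ (toList v)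
Contains231⇔Contains231ᴸ v = mk⇔ (λ (i , j , k , occ) → occurrence⇒ v i j k occ) (occurrence⇐ v)
  where
  starts⇒ : ∀ {m} (v : Vec ℕ m) {x} j k → toℕ j < toℕ k → lookup v k < x → x < lookup v j →
            Starts231 x (toList v)
  starts⇒ (y ∷ v) zero    (suc k) _         vk<x x<vj = inj₁ (x<vj , lose (lookup-∈ v k) vk<x)
  starts⇒ (y ∷ v) (suc j) (suc k) (s≤s j<k) vk<x x<vj = inj₂ (starts⇒ v j k j<k vk<x x<vj)

  occurrence⇒ : ∀ {m} (v : Vec ℕ m) i j k → Occ231 v i j k → Contains231ᴸ (toList v)
  occurrence⇒ (y ∷ v) zero    (suc j) (suc k) (_ , s≤s j<k , vk<vi , vi<vj) =
    inj₁ (starts⇒ v j k j<k vk<vi vi<vj)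
  occurrence⇒ (y ∷ v) (suc i) (suc j) (suc k) (s≤s i<j , s≤s j<k , vk<vi , vi<vj) =
    inj₂ (occurrence⇒ v i j k (i<j , j<k , vk<vi , vi<vj))

  starts⇐ : ∀ {m} (v : Vec ℕ m) {x} → Starts231 x (toList v) →
            ∃[ j ] ∃[ k ] (toℕ j < toℕ k × lookup v k < x × x < lookup v j)
  starts⇐ (y ∷ v) (inj₁ (x<y , c<x)) =
    let (k , vk<x) = Any-toList⇒lookup v c<x in zero , suc k , s≤s z≤n , vk<x , x<y
  starts⇐ (y ∷ v) (inj₂ s) =
    let (j , k , j<k , vk<x , x<vj) = starts⇐ v s in suc j , suc k , s≤s j<k , vk<x , x<vj

  occurrence⇐ : ∀ {m} (v : Vec ℕ m) → Contains231ᴸ (toList v) → Contains231 v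
  occurrence⇐ (x ∷ v) (inj₁ s) =
    let (j , k , j<k , vk<x , x<vj) = starts⇐ v s in zero , suc j , suc k , s≤s z≤n , s≤s j<k , vk<x , x<vj
  occurrence⇐ (x ∷ v) (inj₂ c) =
    let (i , j , k , i<j , j<k , occ) = occurrence⇐ v c in suc i , suc j , suc k , s≤s i<j , s≤s j<k , occ

toList-removeAt : ∀ {m} (v : Vec ℕ (suc m)) i →
                  ∃[ ys ] ∃[ zs ] (toList v ≡ ys ++ lookup v i ∷ zs × toList (removeAt v i) ≡ ys ++ zs)
toList-removeAt (x ∷ v)           zero    = [] , toList v , refl , refl
toList-removeAt (x ∷ v@(_ ∷ _)) (suc i) =
  let (ys , zs , v≡ , v-i≡) = toList-removeAt v i in x ∷ ys , zs , cong (x ∷_) v≡ , cong (x ∷_) v-i≡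

removeAt-of-split : ∀ {m} (v : Vec ℕ (suc m)) ys {w zs} → toList v ≡ ys ++ w ∷ zs →
                    ∃[ i ] (lookup v i ≡ w × toList (removeAt v i) ≡ ys ++ zs)
removeAt-of-split (x ∷ v)           []       eq = zero , List.∷-injective eq
removeAt-of-split (x ∷ [])          (y ∷ []) ()
removeAt-of-split (x ∷ [])          (y ∷ _ ∷ _) ()
removeAt-of-split (x ∷ v@(_ ∷ _)) (y ∷ ys) eq with List.∷-injective eq
... | refl , v≡ = let (i , vi≡w , v-i≡) = removeAt-of-split v ys v≡ in suc i , vi≡w , cong (x ∷_) v-i≡

shiftDown-cases : ∀ v w → w ≢ v → (w < v × shiftDown v w ≡ w) ⊎ (v < w × suc (shiftDown v w) ≡ w)
shiftDown-cases v w w≢v with w <ᵇ v in w<ᵇv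
... | true  = inj₁ (<ᵇ⇒< w v (subst T (sym w<ᵇv) _) , refl)
... | false = inj₂ (v<w , suc-∸1 v<w)
  where
  v<w : v < w
  v<w = ≤∧≢⇒< (≮⇒≥ (λ w<v → subst T w<ᵇv (<⇒<ᵇ w<v))) (w≢v ∘ sym)
  suc-∸1 : ∀ {v w} → v < w → suc (w ∸ 1) ≡ w
  suc-∸1 {w = suc w} _ = refl

shiftDown-<⇔ : ∀ v {x y} → x ≢ v → y ≢ v → x < y ⇔ shiftDown v x < shiftDown v y
shiftDown-<⇔ v {x} {y} x≢v y≢v with shiftDown-cases v x x≢v | shiftDown-cases v y y≢v
... | inj₁ (x<v , ↓x≡x) | inj₁ (y<v , ↓y≡y) =
  mk⇔ (subst₂ _<_ (sym ↓x≡x) (sym ↓y≡y)) (subst₂ _<_ ↓x≡x ↓y≡y)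
... | inj₁ (x<v , ↓x≡x) | inj₂ (v<y , 1+↓y≡y) =
  mk⇔ (λ _ → subst (_< shiftDown v y) (sym ↓x≡x) (<-≤-trans x<v (≤-pred (subst (v <_) (sym 1+↓y≡y) v<y))))
      (λ _ → <-trans x<v v<y)
... | inj₂ (v<x , 1+↓x≡x) | inj₁ (y<v , ↓y≡y) =
  mk⇔ (λ x<y → ⊥-elim (<-asym (<-trans y<v v<x) x<y))
      (λ ↓x<↓y → ⊥-elim (<-asym y<v (≤-<-trans (≤-pred (subst (v <_) (sym 1+↓x≡x) v<x))
                                                (subst (shiftDown v x <_) ↓y≡y ↓x<↓y))))
... | inj₂ (v<x , 1+↓x≡x) | inj₂ (v<y , 1+↓y≡y) =
  mk⇔ (λ x<y → ≤-pred (subst₂ _<_ (sym 1+↓x≡x) (sym 1+↓y≡y) x<y))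
      (λ ↓x<↓y → subst₂ _<_ 1+↓x≡x 1+↓y≡y (s≤s ↓x<↓y))

Unique⇒≢-deleted : ∀ (ys : List ℕ) {w zs} → Unique (ys ++ w ∷ zs) → All (_≢ w) (ys ++ zs)
Unique⇒≢-deleted ys ys-w-zs! with Unique-++⁻ ys ys-w-zs!
... | _ , w∉zs ∷ _ , disjoint =
  All.++⁺ (All.tabulate λ y∈ys y≡w → disjoint y∈ys (here y≡w)) (All.map (λ w≢z z≡w → w≢z (sym z≡w)) w∉zs)

InAv231+1⇔InAv231+1ᴸ : ∀ {m} (v : Vec ℕ m) → Unique (toList v) → InAv231+1 v ⇔ InAv231+1ᴸ (toList v)
InAv231+1⇔InAv231+1ᴸ []      _  = mk⇔ (λ _ → inj₁ λ ()) (λ _ (i , _) → case i of λ ())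
InAv231+1⇔InAv231+1ᴸ v@(_ ∷ _) v! = mk⇔ to′ from′
  where
  deleted : ∀ i → toList (deleteEntry v i) ≡ map (shiftDown (lookup v i)) (toList (removeAt v i))
  deleted i = Vec.toList-map (shiftDown (lookup v i)) (removeAt v i)

  to′ : InAv231+1 v → InAv231+1ᴸ (toList v)
  to′ (inj₁ avoids) = inj₁ (avoids ∘ from (Contains231⇔Contains231ᴸ v))
  to′ (inj₂ (i , avoids)) =
    let (ys , zs , v≡ , v-i≡) = toList-removeAt v i
        open OrderEmbedding (shiftDown (lookup v i)) (_≢ lookup v i) (shiftDown-<⇔ (lookup v i))
    in inj₂ (ys , lookup v i , zs , v≡ ,
             avoids ∘ from (Contains231⇔Contains231ᴸ (deleteEntry v i))
                    ∘ subst Contains231ᴸ (sym (trans (deleted i) (cong (map _) v-i≡)))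
                    ∘ Contains231ᴸ-map⁺ (Unique⇒≢-deleted ys (subst Unique v≡ v!)))

  from′ : InAv231+1ᴸ (toList v) → InAv231+1 v
  from′ (inj₁ ¬c) = inj₁ (¬c ∘ to (Contains231⇔Contains231ᴸ v))
  from′ (inj₂ (ys , w , zs , v≡ , ¬c)) with removeAt-of-split v ys v≡
  ... | i , refl , v-i≡ =
    let open OrderEmbedding (shiftDown w) (_≢ w) (shiftDown-<⇔ w) in
    inj₂ (i , ¬c ∘ Contains231ᴸ-map⁻ (Unique⇒≢-deleted ys (subst Unique v≡ v!))
                 ∘ subst Contains231ᴸ (trans (deleted i) (cong (map _) v-i≡))
                 ∘ to (Contains231⇔Contains231ᴸ (deleteEntry v i)))

index-in-prefix : ∀ {m} (v : Vec ℕ m) α {w γ a} → toList v ≡ α ++ w ∷ γ → a ∈ α →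
                  ∃[ i ] (toℕ i < length α × lookup v i ≡ a)
index-in-prefix (x ∷ v) (y ∷ α) eq (here refl) = zero , s≤s z≤n , List.∷-injectiveˡ eq
index-in-prefix (x ∷ v) (y ∷ α) eq (there a∈α) =
  let (i , i<|α| , vi≡a) = index-in-prefix v α (List.∷-injectiveʳ eq) a∈α in suc i , s≤s i<|α| , vi≡a

index-of-middle : ∀ {m} (v : Vec ℕ m) α {w γ} → toList v ≡ α ++ w ∷ γ →
                  ∃[ p ] (toℕ p ≡ length α × lookup v p ≡ w)
index-of-middle (x ∷ v) []      eq = zero , refl , List.∷-injectiveˡ eq
index-of-middle (x ∷ v) (y ∷ α) eq =
  let (p , p≡|α| , vp≡w) = index-of-middle v α (List.∷-injectiveʳ eq) in suc p , cong suc p≡|α| , vp≡w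

index-in-suffix : ∀ {m} (v : Vec ℕ m) α {w γ c} → toList v ≡ α ++ w ∷ γ → c ∈ γ →
                  ∃[ k ] (length α < toℕ k × lookup v k ≡ c)
index-in-suffix (x ∷ v) []      eq c∈γ =
  let (k , c≡vk) = Any-toList⇒lookup v (subst (_ ∈_) (sym (List.∷-injectiveʳ eq)) c∈γ) in
  suc k , s≤s z≤n , sym c≡vk
index-in-suffix (x ∷ v) (y ∷ α) eq c∈γ =
  let (k , |α|<k , vk≡c) = index-in-suffix v α (List.∷-injectiveʳ eq) c∈γ in suc k , s≤s |α|<k , vk≡c

lookup-in-prefix : ∀ {m} (v : Vec ℕ m) α {w γ i} → toList v ≡ α ++ w ∷ γ → toℕ i < length α →
                   lookup v i ∈ α
lookup-in-prefix (x ∷ v) (y ∷ α) {i = zero}  eq _            = here (List.∷-injectiveˡ eq)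
lookup-in-prefix (x ∷ v) (y ∷ α) {i = suc i} eq (s≤s i<|α|) =
  there (lookup-in-prefix v α (List.∷-injectiveʳ eq) i<|α|)

lookup-in-suffix : ∀ {m} (v : Vec ℕ m) α {w γ i} → toList v ≡ α ++ w ∷ γ → length α < toℕ i →
                   lookup v i ∈ γ
lookup-in-suffix (x ∷ v) []      {i = suc i} eq _            =
  subst (lookup v i ∈_) (List.∷-injectiveʳ eq) (lookup-∈ v i)
lookup-in-suffix (x ∷ v) (y ∷ α) {i = suc i} eq (s≤s |α|<i) =
  lookup-in-suffix v α (List.∷-injectiveʳ eq) |α|<i

MaxNotIn231⇒MaxStacked : ∀ {n} (v : Vec ℕ (suc n)) → IsPermᴸ (suc n) (toList v) →
                         MaxNotIn231 v → MaxStacked n (toList v)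
MaxNotIn231⇒MaxStacked {n} v perm max∉231 with split-at-max perm
... | α , γ , v≡ = α , γ , v≡ , α<γ
  where
  α∩nγ : ∀ {x} → x ∈ α → x ∉ n ∷ γ
  α∩nγ = proj₂ (proj₂ (Unique-++⁻ α (subst Unique v≡ (unique perm))))

  α<γ : Below α γ
  α<γ {a} {c} a∈α c∈γ with <-cmp a c
  ... | tri< a<c _ _ = a<c
  ... | tri≈ _ refl _ = ⊥-elim (α∩nγ a∈α (there c∈γ))
  ... | tri> _ _ c<a
    with index-in-prefix v α v≡ a∈α | index-of-middle v α v≡ | index-in-suffix v α v≡ c∈γ
  ... | i , i<|α| , vi≡a | p , p≡|α| , vp≡n | k , |α|<k , vk≡c =
    ⊥-elim (proj₁ (proj₂ (max∉231 i p k occurrence p greatest)) refl)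
    where
    a<n : a < n
    a<n = ≤∧≢⇒< (subst (_≤ n) vi≡a (≤-pred (bounded perm (lookup-∈ v i))))
                 λ { refl → α∩nγ a∈α (here refl) }
    occurrence : Occ231 v i p k
    occurrence = subst (toℕ i <_) (sym p≡|α|) i<|α| , subst (_< toℕ k) (sym p≡|α|) |α|<k ,
                 subst₂ _<_ (sym vk≡c) (sym vi≡a) c<a , subst₂ _<_ (sym vi≡a) (sym vp≡n) a<n
    greatest : IsGreatestPos v p
    greatest q = subst (lookup v q ≤_) (sym vp≡n) (≤-pred (bounded perm (lookup-∈ v q)))

MaxStacked⇒MaxNotIn231 : ∀ {n} (v : Vec ℕ (suc n)) → IsPermᴸ (suc n) (toList v) →
                         MaxStacked n (toList v) → MaxNotIn231 v
MaxStacked⇒MaxNotIn231 {n} v perm (α , γ , v≡ , α<γ) i j k (i<j , j<k , vk<vi , vi<vj) p greatest =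
  p≢i , p≢j , p≢k
  where
  v≤n : ∀ q → lookup v q ≤ n
  v≤n q = ≤-pred (bounded perm (lookup-∈ v q))

  vp≡n : lookup v p ≡ n
  vp≡n = let (q , n≡vq) = Any-toList⇒lookup v (IsPermᴸ-∈ perm ≤-refl) in
         ≤-antisym (v≤n p) (subst (_≤ lookup v p) (sym n≡vq) (greatest q))

  n∉α : n ∉ α
  n∉α n∈α = proj₂ (proj₂ (Unique-++⁻ α (subst Unique v≡ (unique perm)))) n∈α (here refl)

  n∉γ : n ∉ γ
  n∉γ with Unique-++⁻ α (subst Unique v≡ (unique perm))
  ... | _ , n∉γ ∷ _ , _ = λ n∈γ → All.lookup n∉γ n∈γ refl

  p≢i : p ≢ i
  p≢i refl = <-irrefl refl (<-≤-trans (subst (_< lookup v j) vp≡n vi<vj) (v≤n j))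

  p≢k : p ≢ k
  p≢k refl = <-irrefl refl (<-≤-trans (subst (_< lookup v i) vp≡n vk<vi) (v≤n i))

  -- The entry n sits at position |α| only, so i and k fall into α and γ respectively.
  p≢j : p ≢ j
  p≢j refl with <-cmp (toℕ p) (length α)
  ... | tri< p<|α| _ _ = n∉α (subst (_∈ α) vp≡n (lookup-in-prefix v α v≡ p<|α|))
  ... | tri> _ _ |α|<p = n∉γ (subst (_∈ γ) vp≡n (lookup-in-suffix v α v≡ |α|<p))
  ... | tri≈ _ p≡|α| _ =
    <-asym vk<vi (α<γ (lookup-in-prefix v α v≡ (subst (toℕ i <_) p≡|α| i<j))
                      (lookup-in-suffix v α v≡ (subst (_< toℕ k) p≡|α| j<k)))

Av231+1⇔ : ∀ {m} (v : Vec ℕ m) → Av231+1 m v ⇔ (IsPermᴸ m (toList v) × InAv231+1ᴸ (toList v))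
Av231+1⇔ v = mk⇔
  (λ (π , inav) → let perm = to (IsPerm⇔IsPermᴸ v) π in
                  perm , to (InAv231+1⇔InAv231+1ᴸ v (unique perm)) inav)
  (λ (perm , inav) → from (IsPerm⇔IsPermᴸ v) perm , from (InAv231+1⇔InAv231+1ᴸ v (unique perm)) inav)

InAv231+1ᴸ⇒DeletionAvoids231 : ∀ {xs} → Contains231ᴸ xs → InAv231+1ᴸ xs → DeletionAvoids231 xs
InAv231+1ᴸ⇒DeletionAvoids231 c = [ (λ ¬c → ⊥-elim (¬c c)) , id ]′

Target⇔Targetᴸ : ∀ {n} (v : Vec ℕ (suc n)) → Target (suc n) v ⇔ Targetᴸ n (toList v)
Target⇔Targetᴸ v = mk⇔
  (λ (π , inav , c , max∉231) →
    let perm = to (IsPerm⇔IsPermᴸ v) π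
        cᴸ   = to (Contains231⇔Contains231ᴸ v) c in
    perm ,
    (cᴸ , InAv231+1ᴸ⇒DeletionAvoids231 cᴸ (to (InAv231+1⇔InAv231+1ᴸ v (unique perm)) inav)) ,
    MaxNotIn231⇒MaxStacked v perm max∉231)
  (λ (perm , (cᴸ , deletion) , stacked) →
    from (IsPerm⇔IsPermᴸ v) perm ,
    from (InAv231+1⇔InAv231+1ᴸ v (unique perm)) (inj₂ deletion) ,
    from (Contains231⇔Contains231ᴸ v) cᴸ ,
    MaxStacked⇒MaxNotIn231 v perm stacked)

record Av231+1-Count (m a : ℕ) : Set where
  field
    almost avoiding : ℕ
    size-AlmostAv   : HasSize (AlmostAv m) almost
    size-Av         : HasSize (Av m) avoiding
    total≡          : a ≡ almost + avoiding

Av231+1-split : ∀ {m a} → HasCard (Av231+1 m) a → Av231+1-Count m a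
Av231+1-split size with size-filter (size-toList Av231+1⇔ (length≡ ∘ proj₁) size) contains231ᴸ?
... | d , c , size-AlmostAv , size-Av , a≡d+c = record
  { size-AlmostAv = size-cong (λ _ → mk⇔ (λ ((perm , inav) , c) → perm , c , InAv231+1ᴸ⇒DeletionAvoids231 c inav)
                                         (λ (perm , c , deletion) → (perm , inj₂ deletion) , c))
                              size-AlmostAv
  ; size-Av       = size-cong (λ _ → mk⇔ (λ ((perm , _) , ¬c) → perm , ¬c) (λ (perm , ¬c) → (perm , inj₁ ¬c) , ¬c))
                              size-Av
  ; total≡        = a≡d+c
  }

open import Data.Integer using (+_)

sumZ-cong : ∀ n {g h : ℕ → ℤ.ℤ} → (∀ i → g i ≡ h i) → sumZ g n ≡ sumZ h n
sumZ-cong zero    g≡h = g≡h 0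
sumZ-cong (suc n) g≡h = cong₂ ℤ._+_ (sumZ-cong n g≡h) (g≡h (suc n))

targetCoeff-convolution : ∀ n (f c d : ℕ → ℕ) → (∀ i → f i ≡ d i + c i) → (∀ i → c i ≡ catalan i) →
                          + ∑≤ n (λ i → d i * c (n ∸ i) + c i * d (n ∸ i)) ≡ targetCoeff f (suc n)
targetCoeff-convolution n f c d f≡d+c c≡catalan = begin
  + ∑≤ n (λ i → d i * c (n ∸ i) + c i * d (n ∸ i))
    ≡⟨ cong ℤ.+_ (∑≤-distrib-+ n _ _) ⟩
  + (∑≤ n (λ i → d i * c (n ∸ i)) + ∑≤ n (λ i → c i * d (n ∸ i)))
    ≡⟨ cong (λ s → + (∑≤ n (λ i → d i * c (n ∸ i)) + s)) (∑≤-convolution-comm n c d) ⟩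
  + (∑≤ n (λ i → d i * c (n ∸ i)) + ∑≤ n (λ i → d i * c (n ∸ i)))
    ≡⟨ cong ℤ.+_ (double (∑≤ n (λ i → d i * c (n ∸ i)))) ⟩
  + (2 * ∑≤ n (λ i → d i * c (n ∸ i)))
    ≡⟨ ℤ.pos-* 2 (∑≤ n (λ i → d i * c (n ∸ i))) ⟩
  + 2 ℤ.* + ∑≤ n (λ i → d i * c (n ∸ i))
    ≡⟨ cong (+ 2 ℤ.*_) (trans (pos-∑≤ n _) (sumZ-cong n term)) ⟩
  targetCoeff f (suc n)
    ∎
  where
  double : ∀ x → x + x ≡ 2 * x
  double = ℕ-Solver.solve-∀
  cancel : ∀ x y z → ((x ℤ.+ y) ℤ.- y) ℤ.* z ≡ x ℤ.* z
  cancel = ℤ-Solver.solve-∀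
  term : ∀ i → + (d i * c (n ∸ i)) ≡ (+ f i ℤ.- + catalan i) ℤ.* + catalan (n ∸ i)
  term i = begin
    + (d i * c (n ∸ i))
      ≡⟨ ℤ.pos-* (d i) _ ⟩
    + d i ℤ.* + c (n ∸ i)
      ≡⟨ cancel (+ d i) (+ c i) _ ⟨
    (+ (d i + c i) ℤ.- + c i) ℤ.* + c (n ∸ i)
      ≡⟨ cong₂ (λ x y → (+ x ℤ.- + y) ℤ.* + c (n ∸ i)) (sym (f≡d+c i)) (c≡catalan i) ⟩
    (+ f i ℤ.- + catalan i) ℤ.* + c (n ∸ i)
      ≡⟨ cong (λ x → (+ f i ℤ.- + catalan i) ℤ.* + x) (c≡catalan (n ∸ i)) ⟩
    (+ f i ℤ.- + catalan i) ℤ.* + catalan (n ∸ i)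
      ∎

proposition3p2 : (f : ℕ → ℕ) → ((m : ℕ) → HasCard (Av231+1 m) (f m)) →
                 (n a : ℕ) → HasCard (Target n) a → + a ≡ targetCoeff f n
proposition3p2 f size-Av231+1 zero    a size-Target =
  cong +_ (size-unique size-Target (size-empty λ { _ (_ , _ , (() , _) , _) }))
proposition3p2 f size-Av231+1 (suc n) a size-Target = begin
  + a                                                    ≡⟨ cong +_ a≡ ⟩
  + ∑≤ n (λ i → d i * c (n ∸ i) + c i * d (n ∸ i))      ≡⟨ targetCoeff-convolution n f c d (total≡ ∘ split) c≡catalan ⟩
  targetCoeff f (suc n)                                  ∎
  where
  open Av231+1-Count
  split : ∀ m → Av231+1-Count m (f m)
  split m = Av231+1-split (size-Av231+1 m)

  d c : ℕ → ℕ
  d = almost ∘ split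
  c = avoiding ∘ split

  c≡catalan : ∀ m → c m ≡ catalan m
  c≡catalan = segner⇒catalan c (size-unique (size-Av (split 0)) Av-size-zero)
                (λ m → size-unique (size-Av (split (suc m))) (Av-size-suc m c (λ {i} _ → size-Av (split i))))

  a≡ : a ≡ ∑≤ n (λ i → d i * c (n ∸ i) + c i * d (n ∸ i))
  a≡ = size-unique (size-toList Target⇔Targetᴸ (length≡ ∘ proj₁) size-Target)
                   (Targetᴸ-size n c d (λ {i} _ → size-Av (split i)) (λ {i} _ → size-AlmostAv (split i)))
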